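{- Let $N$ be a positive integer and $p$ a prime with $p\mid N$; let $n=\nu_p(N)\ge1$ and $N_p=p^{ -n}N$. Then for $z\in\mathbb H$, $$\Delta_N(z)=\frac{\Delta_{N_p}(p^nz)^{p^n}}{\Delta_{N_p}(p^{n-1}z)^{p^{n-1}}}.$$
   Context: $\Delta(z)=q\prod_{m\ge1}(1-q^m)^{24}$, $q=e^{2\pi iz}$. For a positive integer $M$, $a_M(t)=\sum_{r\mid t}\mu(t/r)\mu(M/r)\frac{\varphi(M)}{\varphi(M/r)}$ ($\mu$ Möbius, $\varphi$ Euler's totient) and $\Delta_M(z)=\prod_{t\mid M}\Delta(tz)^{a_M(t)}$, the product over positive divisors $t$ of $M$. -}

module Defs where

open import Data.Nat as ℕ using (ℕ; zero; suc; _∸_; _^_; _≡ᵇ_)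
open import Data.Nat.DivMod using (_/_; _%_)
open import Data.Nat.Divisibility using (_∣_; _∣?_)
open import Data.Nat.Primality using (Prime; prime?)
open import Data.Nat.Coprimality using (coprime?)
open import Data.Integer as ℤ using (ℤ; +_; -[1+_]; ∣_∣)
open import Data.List using (List; []; _∷_; map; foldr; applyUpTo; upTo; filter; length)
open import Data.Bool.ListAction using (any)
open import Data.Bool using (Bool; true; false; if_then_else_)
open import Data.Product using (_×_; _,_)
open import Relation.Nullary.Decidable using (_×-dec_; does)
open import Relation.Binary.PropositionalEquality using (_≡_)

divisors : ℕ → List ℕ
divisors M = filter (λ d → d ∣? M) (applyUpTo suc M)

-- division of naturals, used only when the divisor is positive and
-- the division is exact (t/r, M/r with r ∣ t ∣ M, and φ(M)/φ(M/r))
_div_ : ℕ → ℕ → ℕ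
a div zero    = zero
a div (suc b) = a / suc b

μ : ℕ → ℤ
μ n = if any (λ d → does ((d ℕ.* d) ∣? n)) (applyUpTo (λ i → suc (suc i)) n)
      then + 0
      else (ℤ.-1ℤ) ℤ.^ length (filter (λ p → prime? p ×-dec p ∣? n) (upTo (suc n)))

φ : ℕ → ℕ
φ n = length (filter (λ k → coprime? k n) (applyUpTo suc n))

a : ℕ → ℕ → ℤ
a M t = foldr ℤ._+_ (+ 0)
  (map (λ r → μ (t div r) ℤ.* μ (M div r) ℤ.* + (φ M div φ (M div r))) (divisors t))

-- Formal power series in q over ℤ (q-expansions), as coefficient functions

PS : Set
PS = ℕ → ℤ

oneS : PS
oneS zero    = + 1
oneS (suc _) = + 0

_⊛_ : PS → PS → PS
(f ⊛ g) k = foldr ℤ._+_ (+ 0) (map (λ i → f i ℤ.* g (k ∸ i)) (upTo (suc k)))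

powS : PS → ℕ → PS
powS f zero    = oneS
powS f (suc k) = f ⊛ powS f k

-- the polynomial 1 - q^m  (used for m ≥ 1)
oneMinusQ : ℕ → PS
oneMinusQ m k = if k ≡ᵇ 0 then + 1 else (if k ≡ᵇ m then ℤ.-1ℤ else + 0)

P : ℕ → PS
P zero    = oneS
P (suc K) = powS (oneMinusQ (suc K)) 24 ⊛ P K

-- q-expansion of Δ = q ∏_{m≥1} (1-q^m)^24. The coefficient of q^k of the
-- infinite product equals that of the truncation P k, since the factors
-- with m > k are ≡ 1 mod q^(k+1).
Δser : PS
Δser zero    = + 0
Δser (suc k) = P k k

-- substitution q ↦ q^t, i.e. f(z) ↦ f(tz)  (used for t ≥ 1 only)
subS : ℕ → PS → PS
subS zero    f k = + 0
subS (suc t) f k = if (k % suc t) ≡ᵇ 0 then f (k / suc t) else + 0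

-- Quotients num/den of q-series (elements of the fraction field of ℤ[[q]])

QS : Set
QS = PS × PS

mulQ : QS → QS → QS
mulQ (a₁ , b₁) (a₂ , b₂) = (a₁ ⊛ a₂ , b₁ ⊛ b₂)

divQ : QS → QS → QS
divQ (a₁ , b₁) (a₂ , b₂) = (a₁ ⊛ b₂ , b₁ ⊛ a₂)

powQ : QS → ℕ → QS
powQ (a₁ , b₁) k = (powS a₁ k , powS b₁ k)

subQ : ℕ → QS → QS
subQ t (a₁ , b₁) = (subS t a₁ , subS t b₁)

zpowQ : PS → ℤ → QS
zpowQ f (+ n)    = (powS f n , oneS)
zpowQ f -[1+ n ] = (oneS , powS f (suc n))

_≈Q_ : QS → QS → Set
(a₁ , b₁) ≈Q (a₂ , b₂) = ∀ k → (a₁ ⊛ b₂) k ≡ (a₂ ⊛ b₁) k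

ΔQ : ℕ → QS
ΔQ M = foldr mulQ (oneS , oneS) (map (λ t → zpowQ (subS t Δser) (a M t)) (divisors M))

{-# OPTIONS --safe #-}
module Submission where

-- Both sides are quotients of products of the series Δ(tz), so it suffices to compare the total
-- exponent of each Δ(sz), s ≤ N; numerators and denominators carry the positive and negative parts
-- of the integer exponents.  On the left the exponent of Δ(sz) is a_N(s) for s ∣ N.  Writing
-- s = p^j t with t ∣ N_p, every divisor of s is p^i r with r ∣ t, and since μ and φ are
-- multiplicative across the coprime factors p^k and r, each term of the divisor sum defining a_N(s)
-- factors, whence a_N(p^j t) = a_{p^n}(p^j) a_{N_p}(t).  Finally a_{p^n}(p^j) is 0 for j < n-1
-- (each of its terms contains some μ(p^k) with k ≥ 2), -p^{n-1} for j = n-1 and p^n for j = n: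
-- exactly the exponents of Δ(p^j t z) in Δ_{N_p}(p^n z)^{p^n} / Δ_{N_p}(p^{n-1} z)^{p^{n-1}}.

open import Defs
open import Algebra.Bundles using (CommutativeMonoid)
open import Algebra.Structures using (IsCommutativeMonoid)
open import Data.Bool using (Bool; true; false; T; if_then_else_)
open import Data.Bool.ListAction using (any)
open import Data.Bool.Properties using (if-eta; if-float)
open import Data.Empty using (⊥-elim)
open import Data.Integer as ℤ using (ℤ; +_; -[1+_]; -1ℤ)
import Data.Integer.Properties as ℤₚ
open import Data.Integer.Tactic.RingSolver using (solve-∀)
open import Data.List using (List; []; _∷_; map; foldr; applyUpTo; upTo; filter; length)
open import Data.List.Membership.Propositional using (_∈_; find; lose)
open import Data.List.Membership.Propositional.Properties using (∈-applyUpTo⁺; ∈-applyUpTo⁻; ∈-filter⁻)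
open import Data.List.Properties using (filter-accept)
open import Data.List.Relation.Unary.All using (All; []; _∷_)
open import Data.List.Relation.Unary.Any using (here; there)
open import Data.List.Relation.Unary.Any.Properties using (any⁺; any⁻)
open import Data.Maybe using (Maybe; just; nothing; maybe)
open import Data.Nat as ℕ using (ℕ; zero; suc; _*_; _^_; _∸_; _<_; _≤_; z≤n; s≤s; NonZero)
open import Data.Nat.Coprimality as Coprimality using (Coprime; coprime?; coprime-+; coprime-divisor; 1-coprimeTo)
open import Data.Nat.Divisibility
open import Data.Nat.DivMod using (_/_; m*n/n≡m; n/1≡n; m*[n/m]≡n; /-*-interchange)
open import Data.Nat.ListAction using (sum; product)
open import Data.Nat.Primality using (Prime; prime?; euclidsLemma; prime⇒nonZero; prime⇒irreducible; prime⇒nonTrivial; ¬prime[1])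
open import Data.Nat.Primality.Factorisation using (factorise; factors; PrimeFactorisation)
import Data.Nat.Properties as ℕₚ
open import Data.Product using (_,_; proj₁; proj₂; ∃-syntax)
open import Data.Sum using (inj₁; inj₂; reduce)
open import Function using (_∘_; id; it)
open import Level using (0ℓ)
open import Relation.Binary.Definitions using (tri<; tri≈; tri>)
import Relation.Binary.Reasoning.Setoid as Setoid-Reasoning
open import Relation.Binary.PropositionalEquality as ≡ using (_≡_; _≢_; _≗_; refl; sym; trans; cong; cong₂)
open import Relation.Nullary using (Dec; yes; no; does; ¬_)
open import Relation.Nullary.Decidable using (dec-true; dec-false; _×-dec_)
open import Relation.Unary using (Decidable)

if-yes : ∀ {a p} {A : Set a} {P : Set p} {x y : A} (P? : Dec P) → P → (if does P? then x else y) ≡ x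
if-yes P? p = cong (λ b → if b then _ else _) (dec-true P? p)

if-no : ∀ {a p} {A : Set a} {P : Set p} {x y : A} (P? : Dec P) → ¬ P → (if does P? then x else y) ≡ y
if-no P? ¬p = cong (λ b → if b then _ else _) (dec-false P? ¬p)

if-⇔ : ∀ {a p q} {A : Set a} {P : Set p} {Q : Set q} {x y : A} (P? : Dec P) (Q? : Dec Q) →
  (P → Q) → (Q → P) → (if does P? then x else y) ≡ (if does Q? then x else y)
if-⇔ (yes _) (yes _) _   _   = refl
if-⇔ (no _)  (no _)  _   _   = refl
if-⇔ (yes p) (no ¬q) p⇒q _   = ⊥-elim (¬q (p⇒q p))
if-⇔ (no ¬p) (yes q) _   q⇒p = ⊥-elim (¬p (q⇒p q))

if-true : ∀ {a} {A : Set a} {b} {x y : A} → T b → (if b then x else y) ≡ x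
if-true {b = true} _ = refl

T-injective : ∀ {b c} → (T b → T c) → (T c → T b) → b ≡ c
T-injective {false} {false} _   _   = refl
T-injective {false} {true}  _   c⇒b = ⊥-elim (c⇒b _)
T-injective {true}  {false} b⇒c _   = ⊥-elim (b⇒c _)
T-injective {true}  {true}  _   _   = refl

T-does⁺ : ∀ {p} {P : Set p} (P? : Dec P) → P → T (does P?)
T-does⁺ (yes _) _ = _
T-does⁺ (no ¬p) p = ¬p p

T-does⁻ : ∀ {p} {P : Set p} (P? : Dec P) → T (does P?) → P
T-does⁻ (yes p) _ = p

∣⇒nonZero : ∀ {d n} .{{_ : NonZero n}} → d ∣ n → NonZero d
∣⇒nonZero {zero}  {n} 0∣n = ⊥-elim (ℕ.≢-nonZero⁻¹ n (0∣⇒≡0 0∣n))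
∣⇒nonZero {suc d} _       = _

prime⇒2≤ : ∀ {p} → Prime p → 2 ≤ p
prime⇒2≤ {p} p-prime = ℕ.nonTrivial⇒n>1 p ⦃ prime⇒nonTrivial p-prime ⦄

prime∤1 : ∀ {p} → Prime p → ¬ p ∣ 1
prime∤1 p-prime p∣1 with ∣1⇒≡1 p∣1
... | refl = ¬prime[1] p-prime

prime∤⇒coprime : ∀ {p r} → Prime p → ¬ p ∣ r → Coprime r p
prime∤⇒coprime p-prime p∤r (d∣r , d∣p) with prime⇒irreducible p-prime d∣p
... | inj₁ d≡1 = d≡1
... | inj₂ refl = ⊥-elim (p∤r d∣r)

coprime-* : ∀ {r a b} → Coprime r a → Coprime r b → Coprime r (a * b)
coprime-* cop-a cop-b (d∣r , d∣ab) =
  cop-b (d∣r , coprime-divisor (λ (e∣d , e∣a) → cop-a (∣-trans e∣d d∣r , e∣a)) d∣ab)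

∣p^k*t⇒∣t : ∀ {p r t} k → Prime p → ¬ p ∣ r → r ∣ p ^ k * t → r ∣ t
∣p^k*t⇒∣t {r = r} {t} zero _ _ r∣t = ≡.subst (r ∣_) (ℕₚ.+-identityʳ t) r∣t
∣p^k*t⇒∣t {p} {r} {t} (suc k) p-prime p∤r r∣pᵏ⁺¹t =
  ∣p^k*t⇒∣t k p-prime p∤r (coprime-divisor (prime∤⇒coprime p-prime p∤r) (≡.subst (r ∣_) (ℕₚ.*-assoc p (p ^ k) t) r∣pᵏ⁺¹t))

div-as-/ : ∀ a b .{{_ : NonZero b}} → a div b ≡ a / b
div-as-/ a (suc b) = refl

div-∣ : ∀ {r t} .{{_ : NonZero r}} → r ∣ t → t div r ∣ t
div-∣ {r} {t} r∣t = ≡.subst (_∣ t) (sym (div-as-/ t r)) (m/n∣m r∣t)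

div-* : ∀ {a b c d} .{{_ : NonZero b}} .{{_ : NonZero d}} → b ∣ a → d ∣ c → (a * c) div (b * d) ≡ (a div b) * (c div d)
div-* {a} {b} {c} {d} b∣a d∣c = begin
  (a * c) div (b * d)        ≡⟨ div-as-/ (a * c) (b * d) ⦃ ℕₚ.m*n≢0 b d ⦄ ⟩
  ((a * c) / (b * d)) ⦃ _ ⦄  ≡⟨ /-*-interchange ⦃ _ ⦄ ⦃ _ ⦄ ⦃ ℕₚ.m*n≢0 b d ⦄ b∣a d∣c ⟩
  (a / b) * (c / d)          ≡⟨ cong₂ _*_ (div-as-/ a b) (div-as-/ c d) ⟨
  (a div b) * (c div d)      ∎
  where open ≡.≡-Reasoning

-- Sums over ranges and over divisors in a commutative monoid

module RangeSum {c ℓ} (CM : CommutativeMonoid c ℓ) where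

  open CommutativeMonoid CM renaming
    ( Carrier to A; _∙_ to _+_; ε to 0#; ∙-cong to +-cong; ∙-congˡ to +-congˡ; ∙-congʳ to +-congʳ
    ; assoc to +-assoc; comm to +-comm; identityˡ to +-identityˡ; identityʳ to +-identityʳ
    ; refl to ≈-refl; sym to ≈-sym; trans to ≈-trans)
  open Setoid-Reasoning setoid
  open import Algebra.Properties.CommutativeSemigroup commutativeSemigroup using (interchange)

  ∑ : ℕ → (ℕ → A) → A
  ∑ zero    f = 0#
  ∑ (suc n) f = ∑ n f + f n

  ∑-cong-< : ∀ n {f g : ℕ → A} → (∀ i → i < n → f i ≈ g i) → ∑ n f ≈ ∑ n g
  ∑-cong-< zero    f≈g = ≈-refl
  ∑-cong-< (suc n) f≈g = +-cong (∑-cong-< n (λ i i<n → f≈g i (ℕₚ.m<n⇒m<1+n i<n))) (f≈g n ℕₚ.≤-refl)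

  ∑-cong : ∀ n {f g : ℕ → A} → (∀ i → f i ≈ g i) → ∑ n f ≈ ∑ n g
  ∑-cong n f≈g = ∑-cong-< n (λ i _ → f≈g i)

  ∑-zero : ∀ n {f : ℕ → A} → (∀ i → i < n → f i ≈ 0#) → ∑ n f ≈ 0#
  ∑-zero zero    f≈0 = ≈-refl
  ∑-zero (suc n) f≈0 = ≈-trans (+-cong (∑-zero n (λ i i<n → f≈0 i (ℕₚ.m<n⇒m<1+n i<n))) (f≈0 n ℕₚ.≤-refl)) (+-identityˡ 0#)

  ∑-distrib-+ : ∀ n (f g : ℕ → A) → ∑ n (λ i → f i + g i) ≈ ∑ n f + ∑ n g
  ∑-distrib-+ zero    f g = ≈-sym (+-identityˡ 0#)
  ∑-distrib-+ (suc n) f g = ≈-trans (+-congʳ (∑-distrib-+ n f g)) (interchange (∑ n f) (∑ n g) (f n) (g n))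

  ∑-suc-front : ∀ n (f : ℕ → A) → ∑ (suc n) f ≈ f 0 + ∑ n (λ i → f (suc i))
  ∑-suc-front zero    f = ≈-trans (+-identityˡ (f 0)) (≈-sym (+-identityʳ (f 0)))
  ∑-suc-front (suc n) f = ≈-trans (+-congʳ (∑-suc-front n f)) (+-assoc _ _ _)

  ∑-+ : ∀ m n (f : ℕ → A) → ∑ (m ℕ.+ n) f ≈ ∑ m f + ∑ n (λ i → f (m ℕ.+ i))
  ∑-+ m zero    f = ≈-trans (reflexive (cong (λ k → ∑ k f) (ℕₚ.+-identityʳ m))) (≈-sym (+-identityʳ (∑ m f)))
  ∑-+ m (suc n) f = begin
    ∑ (m ℕ.+ suc n) f                                ≡⟨ cong (λ k → ∑ k f) (ℕₚ.+-suc m n) ⟩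
    ∑ (m ℕ.+ n) f + f (m ℕ.+ n)                      ≈⟨ +-congʳ (∑-+ m n f) ⟩
    (∑ m f + ∑ n (λ i → f (m ℕ.+ i))) + f (m ℕ.+ n)  ≈⟨ +-assoc _ _ _ ⟩
    ∑ m f + ∑ (suc n) (λ i → f (m ℕ.+ i))            ∎

  ∑-reverse : ∀ n (f : ℕ → A) → ∑ n f ≈ ∑ n (λ i → f (n ∸ suc i))
  ∑-reverse zero    f = ≈-refl
  ∑-reverse (suc n) f = begin
    ∑ n f + f n                          ≈⟨ +-comm _ _ ⟩
    f n + ∑ n f                          ≈⟨ +-congˡ (∑-reverse n f) ⟩
    f n + ∑ n (λ i → f (n ∸ suc i))      ≈⟨ ∑-suc-front n _ ⟨
    ∑ (suc n) (λ i → f (suc n ∸ suc i))  ∎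

  ∑-extend : ∀ {m n} {f : ℕ → A} → m ≤ n → (∀ i → m ≤ i → i < n → f i ≈ 0#) → ∑ n f ≈ ∑ m f
  ∑-extend {m} {n} {f} m≤n f≈0 = begin
    ∑ n f                                  ≡⟨ cong (λ k → ∑ k f) (ℕₚ.m+[n∸m]≡n m≤n) ⟨
    ∑ (m ℕ.+ (n ∸ m)) f                    ≈⟨ ∑-+ m (n ∸ m) f ⟩
    ∑ m f + ∑ (n ∸ m) (λ i → f (m ℕ.+ i))  ≈⟨ +-congˡ (∑-zero (n ∸ m) tail≈0) ⟩
    ∑ m f + 0#                             ≈⟨ +-identityʳ _ ⟩
    ∑ m f                                  ∎
    where
    tail≈0 : ∀ i → i < n ∸ m → f (m ℕ.+ i) ≈ 0#
    tail≈0 i i<n∸m = f≈0 (m ℕ.+ i) (ℕₚ.m≤m+n m i) (≡.subst (m ℕ.+ i <_) (ℕₚ.m+[n∸m]≡n m≤n) (ℕₚ.+-monoʳ-< m i<n∸m))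

  ∑-indicator : ∀ n {s} (g : ℕ → A) → s < n → ∑ n (λ i → if does (i ℕ.≟ s) then g i else 0#) ≈ g s
  ∑-indicator (suc n) {s} g s<1+n with n ℕ.≟ s
  ... | yes refl = ≈-trans (+-cong (∑-zero n off) (reflexive (if-yes (n ℕ.≟ n) refl))) (+-identityˡ (g n))
    where
    off : ∀ i → i < n → (if does (i ℕ.≟ n) then g i else 0#) ≈ 0#
    off i i<n = reflexive (if-no (i ℕ.≟ n) (ℕₚ.<⇒≢ i<n))
  ... | no n≢s = ≈-trans (+-cong (∑-indicator n g s<n) (reflexive (if-no (n ℕ.≟ s) n≢s))) (+-identityʳ _)
    where
    s<n : s < n
    s<n = ℕₚ.≤∧≢⇒< (ℕₚ.≤-pred s<1+n) (λ s≡n → n≢s (sym s≡n))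

  ∑-multiples : ∀ k .{{_ : NonZero k}} K (h : ℕ → A) →
    ∑ (k * K) (λ i → if does (k ∣? i) then h i else 0#) ≈ ∑ K (λ j → h (k * j))
  ∑-multiples k zero h = reflexive (cong (λ n → ∑ n (λ i → if does (k ∣? i) then h i else 0#)) (ℕₚ.*-zeroʳ k))
  ∑-multiples k@(suc k′) (suc K) h = begin
    ∑ (k * suc K) F                                  ≡⟨ cong (λ n → ∑ n F) (trans (ℕₚ.*-suc k K) (ℕₚ.+-comm k (k * K))) ⟩
    ∑ (k * K ℕ.+ k) F                                ≈⟨ ∑-+ (k * K) k F ⟩
    ∑ (k * K) F + ∑ k (λ i → F (k * K ℕ.+ i))        ≈⟨ +-cong (∑-multiples k K h) (∑-suc-front k′ _) ⟩
    ∑ K (λ j → h (k * j)) + (F (k * K ℕ.+ 0) + ∑ k′ (λ i → F (k * K ℕ.+ suc i)))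
      ≈⟨ +-congˡ (+-cong (reflexive multiple) (∑-zero k′ nonMultiple)) ⟩
    ∑ K (λ j → h (k * j)) + (h (k * K) + 0#)         ≈⟨ +-congˡ (+-identityʳ _) ⟩
    ∑ (suc K) (λ j → h (k * j))                      ∎
    where
    F : ℕ → A
    F i = if does (k ∣? i) then h i else 0#
    multiple : F (k * K ℕ.+ 0) ≡ h (k * K)
    multiple = trans (if-yes (k ∣? k * K ℕ.+ 0) (∣m∣n⇒∣m+n (m∣m*n K) (k ∣0))) (cong h (ℕₚ.+-identityʳ _))
    nonMultiple : ∀ i → i < k′ → F (k * K ℕ.+ suc i) ≈ 0#
    nonMultiple i i<k′ = reflexive (if-no (k ∣? _) (λ k∣ → ℕₚ.<⇒≱ (s≤s i<k′) (∣⇒≤ (∣m+n∣m⇒∣n k∣ (m∣m*n K)))))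

  listSum : List A → A
  listSum = foldr _+_ 0#

  listSum-cong-∈ : ∀ (l : List ℕ) {F G : ℕ → A} → (∀ {t} → t ∈ l → F t ≈ G t) → listSum (map F l) ≈ listSum (map G l)
  listSum-cong-∈ []      F≈G = ≈-refl
  listSum-cong-∈ (t ∷ l) F≈G = +-cong (F≈G (here refl)) (listSum-cong-∈ l (F≈G ∘ there))

  listSum-applyUpTo : ∀ n (f : ℕ → A) (g : ℕ → ℕ) → listSum (map f (applyUpTo g n)) ≈ ∑ n (λ i → f (g i))
  listSum-applyUpTo zero    f g = ≈-refl
  listSum-applyUpTo (suc n) f g = ≈-trans (+-congˡ (listSum-applyUpTo n f (λ i → g (suc i)))) (≈-sym (∑-suc-front n _))

  listSum-filter : ∀ {p} {P : ℕ → Set p} (P? : Decidable P) (f : ℕ → A) xs →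
    listSum (map f (filter P? xs)) ≈ listSum (map (λ x → if does (P? x) then f x else 0#) xs)
  listSum-filter P? f []       = ≈-refl
  listSum-filter P? f (x ∷ xs) with does (P? x)
  ... | true  = +-congˡ (listSum-filter P? f xs)
  ... | false = ≈-trans (listSum-filter P? f xs) (≈-sym (+-identityˡ _))

  module _ {h : A → A} (h-+ : ∀ x y → h (x + y) ≈ h x + h y) (h-0 : h 0# ≈ 0#) where

    ∑-homo : ∀ n (f : ℕ → A) → ∑ n (λ i → h (f i)) ≈ h (∑ n f)
    ∑-homo zero    f = ≈-sym h-0
    ∑-homo (suc n) f = ≈-trans (+-congʳ (∑-homo n f)) (≈-sym (h-+ (∑ n f) (f n)))

    listSum-homo : ∀ (l : List ℕ) (F : ℕ → A) → h (listSum (map F l)) ≈ listSum (map (λ t → h (F t)) l)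
    listSum-homo []      F = h-0
    listSum-homo (t ∷ l) F = ≈-trans (h-+ (F t) _) (+-congˡ (listSum-homo l F))

module DivisorSum {c ℓ} (CM : CommutativeMonoid c ℓ) where

  open RangeSum CM public
  open CommutativeMonoid CM renaming
    ( Carrier to A; _∙_ to _+_; ε to 0#; ∙-cong to +-cong; ∙-congˡ to +-congˡ; ∙-congʳ to +-congʳ
    ; identityˡ to +-identityˡ; identityʳ to +-identityʳ; refl to ≈-refl; sym to ≈-sym; trans to ≈-trans)
  open Setoid-Reasoning setoid

  divisorSum : ℕ → (ℕ → A) → A
  divisorSum M G = ∑ (suc M) (λ r → if does (r ∣? M) then G r else 0#)

  listSum-divisors : ∀ M .{{_ : NonZero M}} (G : ℕ → A) → listSum (map G (divisors M)) ≈ divisorSum M G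
  listSum-divisors M G = begin
    listSum (map G (divisors M))       ≈⟨ listSum-filter (_∣? M) G (applyUpTo suc M) ⟩
    listSum (map H (applyUpTo suc M))  ≈⟨ listSum-applyUpTo M H suc ⟩
    ∑ M (λ i → H (suc i))              ≈⟨ +-identityˡ _ ⟨
    0# + ∑ M (λ i → H (suc i))         ≡⟨ cong (_+ ∑ M (λ i → H (suc i))) (if-no (0 ∣? M) (ℕ.≢-nonZero⁻¹ M ∘ 0∣⇒≡0)) ⟨
    H 0 + ∑ M (λ i → H (suc i))        ≈⟨ ∑-suc-front M H ⟨
    divisorSum M G                     ∎
    where
    H : ℕ → A
    H r = if does (r ∣? M) then G r else 0#

  divisorSum-cong : ∀ M {G H : ℕ → A} → (∀ r → r ∣ M → G r ≈ H r) → divisorSum M G ≈ divisorSum M H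
  divisorSum-cong M {G} {H} G≈H = ∑-cong (suc M) term
    where
    term : ∀ r → (if does (r ∣? M) then G r else 0#) ≈ (if does (r ∣? M) then H r else 0#)
    term r with r ∣? M
    ... | yes r∣M = G≈H r r∣M
    ... | no  _   = ≈-refl

  divisorSum-zero : ∀ M {G : ℕ → A} → (∀ r → r ∣ M → G r ≈ 0#) → divisorSum M G ≈ 0#
  divisorSum-zero M G≈0 = ≈-trans (divisorSum-cong M G≈0) (∑-zero (suc M) (λ r _ → reflexive (if-eta (does (r ∣? M)))))

  divisorSum-indicator : ∀ M {q} .{{_ : NonZero M}} (G : ℕ → A) → q ∣ M →
    divisorSum M (λ r → if does (r ℕ.≟ q) then G r else 0#) ≈ G q
  divisorSum-indicator M {q} G q∣M = ≈-trans (∑-cong (suc M) restrict) (∑-indicator (suc M) G (s≤s (∣⇒≤ q∣M)))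
    where
    restrict : ∀ r → (if does (r ∣? M) then (if does (r ℕ.≟ q) then G r else 0#) else 0#) ≈ (if does (r ℕ.≟ q) then G r else 0#)
    restrict r with r ℕ.≟ q
    ... | yes refl = reflexive (if-yes (r ∣? M) q∣M)
    ... | no  r≢q  = reflexive (trans (cong (λ x → if does (r ∣? M) then x else 0#) (if-no (r ℕ.≟ q) r≢q))
                                      (trans (if-eta (does (r ∣? M))) (sym (if-no (r ℕ.≟ q) r≢q))))

  divisorSum-1 : ∀ (G : ℕ → A) → divisorSum 1 G ≈ G 1
  divisorSum-1 G = ≈-trans (+-congʳ (+-identityˡ 0#)) (+-identityˡ (G 1))

  divisorSum-homo : ∀ {h : A → A} → (∀ x y → h (x + y) ≈ h x + h y) → h 0# ≈ 0# →
    ∀ M (G : ℕ → A) → divisorSum M (λ r → h (G r)) ≈ h (divisorSum M G)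
  divisorSum-homo {h} h-+ h-0 M G = ≈-trans (∑-cong (suc M) term) (∑-homo h-+ h-0 (suc M) _)
    where
    term : ∀ r → (if does (r ∣? M) then h (G r) else 0#) ≈ h (if does (r ∣? M) then G r else 0#)
    term r with does (r ∣? M)
    ... | true  = ≈-refl
    ... | false = ≈-sym h-0

  divisorSum-multiples : ∀ k m .{{_ : NonZero k}} .{{_ : NonZero m}} (G : ℕ → A) →
    ∑ (suc (k * m)) (λ r → if does (k ∣? r) then (if does (r ∣? k * m) then G r else 0#) else 0#) ≈ divisorSum m (λ r → G (k * r))
  divisorSum-multiples k m G = begin
    ∑ (suc (k * m)) F               ≈⟨ ∑-extend km<k[1+m] beyond ⟨
    ∑ (k * suc m) F                 ≈⟨ ∑-multiples k (suc m) H ⟩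
    ∑ (suc m) (λ r → H (k * r))     ≈⟨ ∑-cong (suc m) (λ r → reflexive (if-⇔ (k * r ∣? k * m) (r ∣? m) (*-cancelˡ-∣ k) (*-monoʳ-∣ k))) ⟩
    divisorSum m (λ r → G (k * r))  ∎
    where
    instance
      km≢0 : NonZero (k * m)
      km≢0 = ℕₚ.m*n≢0 k m
    H F : ℕ → A
    H r = if does (r ∣? k * m) then G r else 0#
    F r = if does (k ∣? r) then H r else 0#
    km<k[1+m] : suc (k * m) ≤ k * suc m
    km<k[1+m] = ≡.subst (suc (k * m) ≤_) (sym (ℕₚ.*-suc k m)) (ℕₚ.+-monoˡ-≤ (k * m) (ℕ.>-nonZero⁻¹ k))
    beyond : ∀ r → suc (k * m) ≤ r → r < k * suc m → F r ≈ 0#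
    beyond r km<r _ with does (k ∣? r)
    ... | true  = reflexive (if-no (r ∣? k * m) (>⇒∤ km<r))
    ... | false = ≈-refl

  module _ {p t} (p-prime : Prime p) (p∤t : ¬ p ∣ t) .{{_ : NonZero t}} where

    private instance
      p≢0 : NonZero p
      p≢0 = prime⇒nonZero p-prime

    divisorSum-prime-to-p : ∀ j (G : ℕ → A) →
      ∑ (suc (p ^ suc j * t)) (λ r → if does (p ∣? r) then 0# else (if does (r ∣? p ^ suc j * t) then G r else 0#)) ≈ divisorSum t G
    divisorSum-prime-to-p j G = ≈-trans (∑-cong (suc M) term) (∑-extend (s≤s (∣⇒≤ t∣M)) (λ r t<r _ → reflexive (if-no (r ∣? t) (>⇒∤ t<r))))
      where
      M : ℕ
      M = p ^ suc j * t
      instance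
        M≢0 : NonZero M
        M≢0 = ℕₚ.m*n≢0 (p ^ suc j) t ⦃ ℕₚ.m^n≢0 p (suc j) ⦄
      t∣M : t ∣ M
      t∣M = n∣m*n (p ^ suc j)
      term : ∀ r → (if does (p ∣? r) then 0# else (if does (r ∣? M) then G r else 0#)) ≈ (if does (r ∣? t) then G r else 0#)
      term r with p ∣? r
      ... | yes p∣r = reflexive (sym (if-no (r ∣? t) (λ r∣t → p∤t (∣-trans p∣r r∣t))))
      ... | no  p∤r = reflexive (if-⇔ (r ∣? M) (r ∣? t) (∣p^k*t⇒∣t (suc j) p-prime p∤r) (λ r∣t → ∣-trans r∣t t∣M))

    divisorSum-p^[1+j]* : ∀ j (G : ℕ → A) → divisorSum (p ^ suc j * t) G ≈ divisorSum t G + divisorSum (p ^ j * t) (λ r → G (p * r))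
    divisorSum-p^[1+j]* j G = begin
      divisorSum (p ^ suc j * t) G                                        ≈⟨ ∑-cong (suc (p ^ suc j * t)) split ⟩
      ∑ (suc (p ^ suc j * t)) (λ r → Hprime r + Hmultiple r)              ≈⟨ ∑-distrib-+ (suc (p ^ suc j * t)) Hprime Hmultiple ⟩
      ∑ (suc (p ^ suc j * t)) Hprime + ∑ (suc (p ^ suc j * t)) Hmultiple  ≈⟨ +-congˡ (reflexive (cong (λ n → ∑ (suc n) (multiplesIn n)) (ℕₚ.*-assoc p (p ^ j) t))) ⟩
      ∑ (suc (p ^ suc j * t)) Hprime + ∑ (suc (p * (p ^ j * t))) (multiplesIn (p * (p ^ j * t)))
                                                                          ≈⟨ +-cong (divisorSum-prime-to-p j G) (divisorSum-multiples p (p ^ j * t) G) ⟩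
      divisorSum t G + divisorSum (p ^ j * t) (λ r → G (p * r))           ∎
      where
      instance
        pʲt≢0 : NonZero (p ^ j * t)
        pʲt≢0 = ℕₚ.m*n≢0 (p ^ j) t ⦃ ℕₚ.m^n≢0 p j ⦄
      multiplesIn : ℕ → ℕ → A
      multiplesIn n r = if does (p ∣? r) then (if does (r ∣? n) then G r else 0#) else 0#
      H Hprime Hmultiple : ℕ → A
      H r = if does (r ∣? p ^ suc j * t) then G r else 0#
      Hprime r = if does (p ∣? r) then 0# else H r
      Hmultiple = multiplesIn (p ^ suc j * t)
      split : ∀ r → H r ≈ Hprime r + Hmultiple r
      split r with does (p ∣? r)
      ... | true  = ≈-sym (+-identityˡ _)
      ... | false = ≈-sym (+-identityʳ _)

    divisorSum-p^j* : ∀ j (G : ℕ → A) → divisorSum (p ^ j * t) G ≈ ∑ (suc j) (λ i → divisorSum t (λ r → G (p ^ i * r)))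
    divisorSum-p^j* zero G = begin
      divisorSum (1 * t) G                            ≡⟨ cong (λ n → divisorSum n G) (ℕₚ.*-identityˡ t) ⟩
      divisorSum t G                                  ≈⟨ divisorSum-cong t (λ r _ → reflexive (cong G (ℕₚ.*-identityˡ r))) ⟨
      divisorSum t (λ r → G (1 * r))                  ≈⟨ +-identityˡ _ ⟨
      ∑ 1 (λ i → divisorSum t (λ r → G (p ^ i * r)))  ∎
    divisorSum-p^j* (suc j) G = begin
      divisorSum (p ^ suc j * t) G
        ≈⟨ divisorSum-p^[1+j]* j G ⟩
      divisorSum t G + divisorSum (p ^ j * t) (λ r → G (p * r))
        ≈⟨ +-cong (divisorSum-cong t (λ r _ → reflexive (cong G (sym (ℕₚ.*-identityˡ r))))) (divisorSum-p^j* j (λ r → G (p * r))) ⟩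
      divisorSum t (λ r → G (1 * r)) + ∑ (suc j) (λ i → divisorSum t (λ r → G (p * (p ^ i * r))))
        ≈⟨ +-congˡ (∑-cong (suc j) (λ i → divisorSum-cong t (λ r _ → reflexive (cong G (sym (ℕₚ.*-assoc p (p ^ i) r)))))) ⟩
      divisorSum t (λ r → G (1 * r)) + ∑ (suc j) (λ i → divisorSum t (λ r → G (p ^ suc i * r)))
        ≈⟨ ∑-suc-front (suc j) _ ⟨
      ∑ (suc (suc j)) (λ i → divisorSum t (λ r → G (p ^ i * r))) ∎

-- Formal power series over ℤ

module ℤ∑ = DivisorSum ℤₚ.+-0-commutativeMonoid

∑-*ˡ : ∀ n c (f : ℕ → ℤ) → ℤ∑.∑ n (λ i → c ℤ.* f i) ≡ c ℤ.* ℤ∑.∑ n f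
∑-*ˡ n c = ℤ∑.∑-homo {c ℤ.*_} (ℤₚ.*-distribˡ-+ c) (ℤₚ.*-zeroʳ c) n

⊛-as-∑ : ∀ f g k → (f ⊛ g) k ≡ ℤ∑.∑ (suc k) (λ i → f i ℤ.* g (k ∸ i))
⊛-as-∑ f g k = ℤ∑.listSum-applyUpTo (suc k) (λ i → f i ℤ.* g (k ∸ i)) (λ i → i)

⊛-cong : ∀ {f f′ g g′ : PS} → f ≗ f′ → g ≗ g′ → f ⊛ g ≗ f′ ⊛ g′
⊛-cong {f} {f′} {g} {g′} f≗f′ g≗g′ k = begin
  (f ⊛ g) k                                 ≡⟨ ⊛-as-∑ f g k ⟩
  ℤ∑.∑ (suc k) (λ i → f i ℤ.* g (k ∸ i))    ≡⟨ ℤ∑.∑-cong (suc k) (λ i → cong₂ ℤ._*_ (f≗f′ i) (g≗g′ (k ∸ i))) ⟩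
  ℤ∑.∑ (suc k) (λ i → f′ i ℤ.* g′ (k ∸ i))  ≡⟨ ⊛-as-∑ f′ g′ k ⟨
  (f′ ⊛ g′) k                               ∎
  where open ≡.≡-Reasoning

⊛-comm : ∀ f g → f ⊛ g ≗ g ⊛ f
⊛-comm f g k = begin
  (f ⊛ g) k                                           ≡⟨ ⊛-as-∑ f g k ⟩
  ℤ∑.∑ (suc k) (λ i → f i ℤ.* g (k ∸ i))              ≡⟨ ℤ∑.∑-reverse (suc k) _ ⟩
  ℤ∑.∑ (suc k) (λ i → f (k ∸ i) ℤ.* g (k ∸ (k ∸ i)))  ≡⟨ ℤ∑.∑-cong-< (suc k) reflect ⟩
  ℤ∑.∑ (suc k) (λ i → g i ℤ.* f (k ∸ i))              ≡⟨ ⊛-as-∑ g f k ⟨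
  (g ⊛ f) k                                           ∎
  where
  open ≡.≡-Reasoning
  reflect : ∀ i → i < suc k → f (k ∸ i) ℤ.* g (k ∸ (k ∸ i)) ≡ g i ℤ.* f (k ∸ i)
  reflect i i<1+k = trans (cong (λ j → f (k ∸ i) ℤ.* g j) (ℕₚ.m∸[m∸n]≡n (ℕₚ.≤-pred i<1+k))) (ℤₚ.*-comm (f (k ∸ i)) (g i))

⊛-identityˡ : ∀ g → oneS ⊛ g ≗ g
⊛-identityˡ g k = begin
  (oneS ⊛ g) k                                          ≡⟨ ⊛-as-∑ oneS g k ⟩
  ℤ∑.∑ (suc k) (λ i → oneS i ℤ.* g (k ∸ i))             ≡⟨ ℤ∑.∑-suc-front k _ ⟩
  + 1 ℤ.* g k ℤ.+ ℤ∑.∑ k (λ i → + 0 ℤ.* g (k ∸ suc i))  ≡⟨ cong₂ ℤ._+_ (ℤₚ.*-identityˡ (g k)) (ℤ∑.∑-zero k (λ _ _ → refl)) ⟩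
  g k ℤ.+ + 0                                           ≡⟨ ℤₚ.+-identityʳ _ ⟩
  g k                                                   ∎
  where open ≡.≡-Reasoning

shift : PS → PS
shift f i = f (suc i)

⊛-at-0 : ∀ f g → (f ⊛ g) 0 ≡ f 0 ℤ.* g 0
⊛-at-0 f g = ℤₚ.+-identityʳ (f 0 ℤ.* g 0)

⊛-at-suc : ∀ f g k → (f ⊛ g) (suc k) ≡ f 0 ℤ.* g (suc k) ℤ.+ (shift f ⊛ g) k
⊛-at-suc f g k =
  trans (⊛-as-∑ f g (suc k)) (trans (ℤ∑.∑-suc-front (suc k) _) (cong (λ x → f 0 ℤ.* g (suc k) ℤ.+ x) (sym (⊛-as-∑ (shift f) g k))))

⊛-linearˡ : ∀ c u v h k → ((λ i → c ℤ.* u i ℤ.+ v i) ⊛ h) k ≡ c ℤ.* (u ⊛ h) k ℤ.+ (v ⊛ h) k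
⊛-linearˡ c u v h k = begin
  ((λ i → c ℤ.* u i ℤ.+ v i) ⊛ h) k
    ≡⟨ ⊛-as-∑ (λ i → c ℤ.* u i ℤ.+ v i) h k ⟩
  ℤ∑.∑ (suc k) (λ i → (c ℤ.* u i ℤ.+ v i) ℤ.* h (k ∸ i))
    ≡⟨ ℤ∑.∑-cong (suc k) (λ i → distrib c (u i) (v i) (h (k ∸ i))) ⟩
  ℤ∑.∑ (suc k) (λ i → c ℤ.* (u i ℤ.* h (k ∸ i)) ℤ.+ v i ℤ.* h (k ∸ i))
    ≡⟨ ℤ∑.∑-distrib-+ (suc k) _ _ ⟩
  ℤ∑.∑ (suc k) (λ i → c ℤ.* (u i ℤ.* h (k ∸ i))) ℤ.+ ℤ∑.∑ (suc k) (λ i → v i ℤ.* h (k ∸ i))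
    ≡⟨ cong₂ ℤ._+_ (trans (∑-*ˡ (suc k) c _) (cong (c ℤ.*_) (sym (⊛-as-∑ u h k)))) (sym (⊛-as-∑ v h k)) ⟩
  c ℤ.* (u ⊛ h) k ℤ.+ (v ⊛ h) k ∎
  where
  open ≡.≡-Reasoning
  distrib : ∀ c a b x → (c ℤ.* a ℤ.+ b) ℤ.* x ≡ c ℤ.* (a ℤ.* x) ℤ.+ b ℤ.* x
  distrib = solve-∀

⊛-assoc : ∀ f g h → (f ⊛ g) ⊛ h ≗ f ⊛ (g ⊛ h)
⊛-assoc f g h zero = begin
  ((f ⊛ g) ⊛ h) 0        ≡⟨ trans (⊛-at-0 (f ⊛ g) h) (cong (ℤ._* h 0) (⊛-at-0 f g)) ⟩
  f 0 ℤ.* g 0 ℤ.* h 0    ≡⟨ ℤₚ.*-assoc (f 0) (g 0) (h 0) ⟩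
  f 0 ℤ.* (g 0 ℤ.* h 0)  ≡⟨ trans (⊛-at-0 f (g ⊛ h)) (cong (f 0 ℤ.*_) (⊛-at-0 g h)) ⟨
  (f ⊛ (g ⊛ h)) 0        ∎
  where open ≡.≡-Reasoning
⊛-assoc f g h (suc k) = begin
  ((f ⊛ g) ⊛ h) (suc k)
    ≡⟨ ⊛-at-suc (f ⊛ g) h k ⟩
  (f ⊛ g) 0 ℤ.* h (suc k) ℤ.+ (shift (f ⊛ g) ⊛ h) k
    ≡⟨ cong₂ ℤ._+_ (cong (ℤ._* h (suc k)) (⊛-at-0 f g)) (⊛-cong {g = h} (⊛-at-suc f g) (λ _ → refl) k) ⟩
  f 0 ℤ.* g 0 ℤ.* h (suc k) ℤ.+ ((λ i → f 0 ℤ.* shift g i ℤ.+ (shift f ⊛ g) i) ⊛ h) k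
    ≡⟨ cong (λ x → f 0 ℤ.* g 0 ℤ.* h (suc k) ℤ.+ x) (⊛-linearˡ (f 0) (shift g) (shift f ⊛ g) h k) ⟩
  f 0 ℤ.* g 0 ℤ.* h (suc k) ℤ.+ (f 0 ℤ.* (shift g ⊛ h) k ℤ.+ ((shift f ⊛ g) ⊛ h) k)
    ≡⟨ cong (λ x → f 0 ℤ.* g 0 ℤ.* h (suc k) ℤ.+ (f 0 ℤ.* (shift g ⊛ h) k ℤ.+ x)) (⊛-assoc (shift f) g h k) ⟩
  f 0 ℤ.* g 0 ℤ.* h (suc k) ℤ.+ (f 0 ℤ.* (shift g ⊛ h) k ℤ.+ (shift f ⊛ (g ⊛ h)) k)
    ≡⟨ regroup (f 0) (g 0) (h (suc k)) ((shift g ⊛ h) k) ((shift f ⊛ (g ⊛ h)) k) ⟩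
  f 0 ℤ.* (g 0 ℤ.* h (suc k) ℤ.+ (shift g ⊛ h) k) ℤ.+ (shift f ⊛ (g ⊛ h)) k
    ≡⟨ cong (λ x → f 0 ℤ.* x ℤ.+ (shift f ⊛ (g ⊛ h)) k) (⊛-at-suc g h k) ⟨
  f 0 ℤ.* (g ⊛ h) (suc k) ℤ.+ (shift f ⊛ (g ⊛ h)) k
    ≡⟨ ⊛-at-suc f (g ⊛ h) k ⟨
  (f ⊛ (g ⊛ h)) (suc k) ∎
  where
  open ≡.≡-Reasoning
  regroup : ∀ a b c d x → a ℤ.* b ℤ.* c ℤ.+ (a ℤ.* d ℤ.+ x) ≡ a ℤ.* (b ℤ.* c ℤ.+ d) ℤ.+ x
  regroup = solve-∀

⊛-isCommutativeMonoid : IsCommutativeMonoid _≗_ _⊛_ oneS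
⊛-isCommutativeMonoid = record
  { isMonoid = record
    { isSemigroup = record
      { isMagma = record
        { isEquivalence = record
          { refl  = λ _ → refl
          ; sym   = λ f≗g k → sym (f≗g k)
          ; trans = λ f≗g g≗h k → trans (f≗g k) (g≗h k) }
        ; ∙-cong = ⊛-cong }
      ; assoc = ⊛-assoc }
    ; identity = ⊛-identityˡ , λ g k → trans (⊛-comm g oneS k) (⊛-identityˡ g k) }
  ; comm = ⊛-comm }

⊛-commutativeMonoid : CommutativeMonoid 0ℓ 0ℓ
⊛-commutativeMonoid = record { isCommutativeMonoid = ⊛-isCommutativeMonoid }

module ⊛-Reasoning = Setoid-Reasoning (CommutativeMonoid.setoid ⊛-commutativeMonoid)
open CommutativeMonoid ⊛-commutativeMonoid using () renaming (trans to ≗-trans)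

subS-as-if : ∀ t .{{_ : NonZero t}} f k → subS t f k ≡ (if does (t ∣? k) then f (k / t) else + 0)
subS-as-if (suc t) f k = refl

subS-at-multiple : ∀ t .{{_ : NonZero t}} f q → subS t f (t * q) ≡ f q
subS-at-multiple t@(suc _) f q = trans (if-yes (t ∣? t * q) (m∣m*n q)) (cong f (trans (cong (_/ t) (ℕₚ.*-comm t q)) (m*n/n≡m q t)))

subS-at-nonmultiple : ∀ t .{{_ : NonZero t}} f {k} → ¬ t ∣ k → subS t f k ≡ + 0
subS-at-nonmultiple t@(suc _) f {k} t∤k = if-no (t ∣? k) t∤k

subS-cong : ∀ t {f g : PS} → f ≗ g → subS t f ≗ subS t g
subS-cong zero    f≗g k = refl
subS-cong (suc t) f≗g k = cong (λ x → if does (suc t ∣? k) then x else + 0) (f≗g (k / suc t))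

subS-oneS : ∀ t .{{_ : NonZero t}} → subS t oneS ≗ oneS
subS-oneS (suc t) zero = refl
subS-oneS t (suc k) with t ∣? suc k
... | no  t∤1+k = subS-at-nonmultiple t oneS t∤1+k
... | yes (divides (suc q) 1+k≡[1+q]t) =
  trans (cong (subS t oneS) (trans 1+k≡[1+q]t (ℕₚ.*-comm (suc q) t))) (subS-at-multiple t oneS (suc q))

-- Only the terms i = t j of the convolution survive, and they are the terms of (f ⊛ g) m.
subS-⊛-at-multiple : ∀ t .{{_ : NonZero t}} f g m → (subS t f ⊛ subS t g) (t * m) ≡ (f ⊛ g) m
subS-⊛-at-multiple t f g m = begin
  (subS t f ⊛ subS t g) (t * m)                                              ≡⟨ ⊛-as-∑ (subS t f) (subS t g) (t * m) ⟩
  ℤ∑.∑ (suc (t * m)) F                                                       ≡⟨ ℤ∑.∑-extend tm<t[1+m] gap ⟨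
  ℤ∑.∑ (t * suc m) F                                                         ≡⟨ ℤ∑.∑-cong (t * suc m) at-multiples ⟩
  ℤ∑.∑ (t * suc m) (λ i → if does (t ∣? i) then f (i / t) ℤ.* G i else + 0)  ≡⟨ ℤ∑.∑-multiples t (suc m) _ ⟩
  ℤ∑.∑ (suc m) (λ j → f (t * j / t) ℤ.* G (t * j))                           ≡⟨ ℤ∑.∑-cong-< (suc m) term ⟩
  ℤ∑.∑ (suc m) (λ j → f j ℤ.* g (m ∸ j))                                     ≡⟨ ⊛-as-∑ f g m ⟨
  (f ⊛ g) m                                                                  ∎
  where
  open ≡.≡-Reasoning
  G F : ℕ → ℤ
  G i = subS t g (t * m ∸ i)
  F i = subS t f i ℤ.* G i
  tm<t[1+m] : suc (t * m) ≤ t * suc m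
  tm<t[1+m] = ≡.subst (suc (t * m) ≤_) (sym (ℕₚ.*-suc t m)) (ℕₚ.+-monoˡ-≤ (t * m) (ℕ.>-nonZero⁻¹ t))
  gap : ∀ i → suc (t * m) ≤ i → i < t * suc m → F i ≡ + 0
  gap i tm<i i<t[1+m] = cong (ℤ._* G i) (subS-at-nonmultiple t f t∤i)
    where
    t∤i : ¬ t ∣ i
    t∤i (divides c refl) = ℕₚ.<⇒≱ (ℕₚ.*-cancelʳ-< t m c (≡.subst (_< c * t) (ℕₚ.*-comm t m) tm<i))
                                  (ℕₚ.≤-pred (ℕₚ.*-cancelʳ-< t c (suc m) (≡.subst (c * t <_) (ℕₚ.*-comm t (suc m)) i<t[1+m])))
  at-multiples : ∀ i → F i ≡ (if does (t ∣? i) then f (i / t) ℤ.* G i else + 0)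
  at-multiples i = trans (cong (ℤ._* G i) (subS-as-if t f i)) (if-float (ℤ._* G i) (does (t ∣? i)))
  term : ∀ j → j < suc m → f (t * j / t) ℤ.* G (t * j) ≡ f j ℤ.* g (m ∸ j)
  term j _ = cong₂ ℤ._*_ (cong f (trans (cong (_/ t) (ℕₚ.*-comm t j)) (m*n/n≡m j t)))
                         (trans (cong (subS t g) (sym (ℕₚ.*-distribˡ-∸ t m j))) (subS-at-multiple t g (m ∸ j)))

subS-⊛-at-nonmultiple : ∀ t .{{_ : NonZero t}} f g {k} → ¬ t ∣ k → (subS t f ⊛ subS t g) k ≡ + 0
subS-⊛-at-nonmultiple t f g {k} t∤k = trans (⊛-as-∑ (subS t f) (subS t g) k) (ℤ∑.∑-zero (suc k) term)
  where
  term : ∀ i → i < suc k → subS t f i ℤ.* subS t g (k ∸ i) ≡ + 0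
  term i i<1+k with t ∣? i
  ... | no  t∤i = cong (ℤ._* subS t g (k ∸ i)) (subS-at-nonmultiple t f t∤i)
  ... | yes t∣i = trans (cong (subS t f i ℤ.*_) (subS-at-nonmultiple t g (λ t∣k∸i → t∤k (∣m∸n∣n⇒∣m t (ℕₚ.≤-pred i<1+k) t∣k∸i t∣i))))
                        (ℤₚ.*-zeroʳ (subS t f i))

subS-⊛ : ∀ t .{{_ : NonZero t}} f g → subS t (f ⊛ g) ≗ subS t f ⊛ subS t g
subS-⊛ t f g k with t ∣? k
... | no  t∤k = trans (subS-at-nonmultiple t (f ⊛ g) t∤k) (sym (subS-⊛-at-nonmultiple t f g t∤k))
... | yes (divides m refl) = begin
  subS t (f ⊛ g) (m * t)         ≡⟨ cong (subS t (f ⊛ g)) (ℕₚ.*-comm m t) ⟩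
  subS t (f ⊛ g) (t * m)         ≡⟨ subS-at-multiple t (f ⊛ g) m ⟩
  (f ⊛ g) m                      ≡⟨ subS-⊛-at-multiple t f g m ⟨
  (subS t f ⊛ subS t g) (t * m)  ≡⟨ cong (subS t f ⊛ subS t g) (ℕₚ.*-comm t m) ⟩
  (subS t f ⊛ subS t g) (m * t)  ∎
  where open ≡.≡-Reasoning

subS-subS : ∀ s t .{{_ : NonZero s}} .{{_ : NonZero t}} f → subS s (subS t f) ≗ subS (s * t) f
subS-subS s t f k with s ∣? k
... | no s∤k = trans (subS-at-nonmultiple s (subS t f) s∤k)
                     (sym (subS-at-nonmultiple (s * t) ⦃ ℕₚ.m*n≢0 s t ⦄ f (s∤k ∘ ∣-trans (m∣m*n t))))
... | yes (divides q refl) =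
  trans (cong (subS s (subS t f)) (ℕₚ.*-comm q s)) (trans (at-multiple q) (cong (subS (s * t) f) (ℕₚ.*-comm s q)))
  where
  instance
    st≢0 : NonZero (s * t)
    st≢0 = ℕₚ.m*n≢0 s t
  at-multiple : ∀ q → subS s (subS t f) (s * q) ≡ subS (s * t) f (s * q)
  at-multiple q with t ∣? q
  ... | no t∤q = trans (subS-at-multiple s (subS t f) q)
                   (trans (subS-at-nonmultiple t f t∤q) (sym (subS-at-nonmultiple (s * t) f (t∤q ∘ *-cancelˡ-∣ s))))
  ... | yes (divides r refl) = begin
    subS s (subS t f) (s * (r * t))  ≡⟨ subS-at-multiple s (subS t f) (r * t) ⟩
    subS t f (r * t)                 ≡⟨ cong (subS t f) (ℕₚ.*-comm r t) ⟩
    subS t f (t * r)                 ≡⟨ subS-at-multiple t f r ⟩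
    f r                              ≡⟨ subS-at-multiple (s * t) f r ⟨
    subS (s * t) f (s * t * r)       ≡⟨ cong (subS (s * t) f) (ℕₚ.*-assoc s t r) ⟩
    subS (s * t) f (s * (t * r))     ≡⟨ cong (λ x → subS (s * t) f (s * x)) (ℕₚ.*-comm t r) ⟩
    subS (s * t) f (s * (r * t))     ∎
    where open ≡.≡-Reasoning

-- Products of powers in a commutative monoid

multiplicity : List ℕ → (ℕ → ℕ) → (ℕ → ℕ) → ℕ → ℕ
multiplicity l base ex s = sum (map (λ t → if does (s ℕ.≟ base t) then ex t else 0) l)

module Monomials {c ℓ} (CM : CommutativeMonoid c ℓ) where

  open CommutativeMonoid CM renaming (Carrier to A; refl to ≈-refl; sym to ≈-sym; trans to ≈-trans)
  open import Algebra.Properties.CommutativeMonoid.Mult CM using (_×_; ×-homo-+)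
  open RangeSum CM using (∑; ∑-cong-<; ∑-zero; ∑-distrib-+; ∑-indicator; listSum)
  open Setoid-Reasoning setoid

  ×-homo : ∀ {h : A → A} → (∀ x y → h (x ∙ y) ≈ h x ∙ h y) → h ε ≈ ε → ∀ n x → h (n × x) ≈ n × h x
  ×-homo h-∙ h-ε zero    x = h-ε
  ×-homo h-∙ h-ε (suc n) x = ≈-trans (h-∙ x (n × x)) (∙-congˡ (×-homo h-∙ h-ε n x))

  ×-ε : ∀ n → n × ε ≈ ε
  ×-ε zero    = ≈-refl
  ×-ε (suc n) = ≈-trans (identityˡ (n × ε)) (×-ε n)

  module _ (x : ℕ → A) where

    monomial : ℕ → (ℕ → ℕ) → A
    monomial B e = ∑ B (λ s → e s × x s)

    monomial-cong : ∀ B {e e′ : ℕ → ℕ} → (∀ s → s < B → e s ≡ e′ s) → monomial B e ≈ monomial B e′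
    monomial-cong B e≡e′ = ∑-cong-< B (λ s s<B → reflexive (cong (_× x s) (e≡e′ s s<B)))

    monomial-∙ : ∀ B (e e′ : ℕ → ℕ) → monomial B e ∙ monomial B e′ ≈ monomial B (λ s → e s ℕ.+ e′ s)
    monomial-∙ B e e′ = ≈-trans (≈-sym (∑-distrib-+ B _ _)) (∑-cong-< B (λ s _ → ≈-sym (×-homo-+ (x s) (e s) (e′ s))))

    monomial-single : ∀ B {b} k → b < B → monomial B (λ s → if does (s ℕ.≟ b) then k else 0) ≈ k × x b
    monomial-single B {b} k b<B = ≈-trans (∑-cong-< B (λ s _ → reflexive (if-float (_× x s) (does (s ℕ.≟ b)))))
                                          (∑-indicator B (λ s → k × x s) b<B)

    listSum-powers : ∀ B (l : List ℕ) (base ex : ℕ → ℕ) → (∀ {t} → t ∈ l → base t < B) →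
      listSum (map (λ t → ex t × x (base t)) l) ≈ monomial B (multiplicity l base ex)
    listSum-powers B []      base ex _      = ≈-sym (∑-zero B (λ _ _ → ≈-refl))
    listSum-powers B (t ∷ l) base ex base<B = begin
      ex t × x (base t) ∙ listSum (map (λ t → ex t × x (base t)) l)
        ≈⟨ ∙-cong (≈-sym (monomial-single B (ex t) (base<B (here refl)))) (listSum-powers B l base ex (base<B ∘ there)) ⟩
      monomial B (λ s → if does (s ℕ.≟ base t) then ex t else 0) ∙ monomial B (multiplicity l base ex)
        ≈⟨ monomial-∙ B (λ s → if does (s ℕ.≟ base t) then ex t else 0) (multiplicity l base ex) ⟩
      monomial B (multiplicity (t ∷ l) base ex) ∎

-- In the monoid (PS, ⊛), n × f is the n-th power of f.
open import Algebra.Properties.CommutativeMonoid.Mult ⊛-commutativeMonoid using (_×_; ×-cong; ×-congʳ; ×-distrib-+; ×-assocˡ)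
module ⊛∑ = RangeSum ⊛-commutativeMonoid
module ⊛M = Monomials ⊛-commutativeMonoid
open ⊛∑ using (listSum)

Δ[_] : ℕ → PS
Δ[ t ] = subS t Δser

_⁺ _⁻ : ℤ → ℕ
(+ n)    ⁺ = n
-[1+ n ] ⁺ = 0
(+ n)    ⁻ = 0
-[1+ n ] ⁻ = suc n

powS-≗-× : ∀ f n → powS f n ≗ n × f
powS-≗-× f zero    = λ _ → refl
powS-≗-× f (suc n) = ⊛-cong {f} (λ _ → refl) (powS-≗-× f n)

zpowQ-numerator : ∀ f e → proj₁ (zpowQ f e) ≗ e ⁺ × f
zpowQ-numerator f (+ n)    = powS-≗-× f n
zpowQ-numerator f -[1+ n ] = λ _ → refl

zpowQ-denominator : ∀ f e → proj₂ (zpowQ f e) ≗ e ⁻ × f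
zpowQ-denominator f (+ n)    = λ _ → refl
zpowQ-denominator f -[1+ n ] = powS-≗-× f (suc n)

numerator-foldr-mulQ : ∀ l (G : ℕ → QS) → proj₁ (foldr mulQ (oneS , oneS) (map G l)) ≡ listSum (map (proj₁ ∘ G) l)
numerator-foldr-mulQ []      G = refl
numerator-foldr-mulQ (t ∷ l) G = cong (λ f → proj₁ (G t) ⊛ f) (numerator-foldr-mulQ l G)

denominator-foldr-mulQ : ∀ l (G : ℕ → QS) → proj₂ (foldr mulQ (oneS , oneS) (map G l)) ≡ listSum (map (proj₂ ∘ G) l)
denominator-foldr-mulQ []      G = refl
denominator-foldr-mulQ (t ∷ l) G = cong (λ f → proj₂ (G t) ⊛ f) (denominator-foldr-mulQ l G)

ΔQ-numerator : ∀ M → proj₁ (ΔQ M) ≗ listSum (map (λ t → a M t ⁺ × Δ[ t ]) (divisors M))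
ΔQ-numerator M k = trans (cong (λ f → f k) (numerator-foldr-mulQ (divisors M) (λ t → zpowQ Δ[ t ] (a M t))))
                         (⊛∑.listSum-cong-∈ (divisors M) (λ {t} _ → zpowQ-numerator Δ[ t ] (a M t)) k)

ΔQ-denominator : ∀ M → proj₂ (ΔQ M) ≗ listSum (map (λ t → a M t ⁻ × Δ[ t ]) (divisors M))
ΔQ-denominator M k = trans (cong (λ f → f k) (denominator-foldr-mulQ (divisors M) (λ t → zpowQ Δ[ t ] (a M t))))
                           (⊛∑.listSum-cong-∈ (divisors M) (λ {t} _ → zpowQ-denominator Δ[ t ] (a M t)) k)

powS-subS-listSum : ∀ c .{{_ : NonZero c}} l (e : ℕ → ℕ) {f : PS} → (∀ {t} → t ∈ l → NonZero t) →
  f ≗ listSum (map (λ t → e t × Δ[ t ]) l) → powS (subS c f) c ≗ listSum (map (λ t → (c * e t) × Δ[ c * t ]) l)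
powS-subS-listSum c l e {f} nonZero f≗ = begin
  powS (subS c f) c                                  ≈⟨ powS-≗-× (subS c f) c ⟩
  c × subS c f                                       ≈⟨ ×-congʳ c (subS-cong c f≗) ⟩
  c × subS c (listSum (map (λ t → e t × Δ[ t ]) l))  ≈⟨ ×-congʳ c (⊛∑.listSum-homo {h = subS c} (subS-⊛ c) (subS-oneS c) l (λ t → e t × Δ[ t ])) ⟩
  c × listSum (map (λ t → subS c (e t × Δ[ t ])) l)  ≈⟨ ×-congʳ c (⊛∑.listSum-cong-∈ l subS-power) ⟩
  c × listSum (map (λ t → e t × Δ[ c * t ]) l)       ≈⟨ ⊛∑.listSum-homo {h = c ×_} (λ x y → ×-distrib-+ x y c) (⊛M.×-ε c) l (λ t → e t × Δ[ c * t ]) ⟩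
  listSum (map (λ t → c × (e t × Δ[ c * t ])) l)     ≈⟨ ⊛∑.listSum-cong-∈ l (λ {t} _ → ×-assocˡ Δ[ c * t ] c (e t)) ⟩
  listSum (map (λ t → (c * e t) × Δ[ c * t ]) l)     ∎
  where
  open ⊛-Reasoning
  subS-power : ∀ {t} → t ∈ l → subS c (e t × Δ[ t ]) ≗ e t × Δ[ c * t ]
  subS-power {t} t∈l = ≗-trans (⊛M.×-homo {h = subS c} (subS-⊛ c) (subS-oneS c) (e t) Δ[ t ])
                               (×-congʳ (e t) (subS-subS c t ⦃ it ⦄ ⦃ nonZero t∈l ⦄ Δser))

-- The Möbius function

module ℕ∑ = DivisorSum ℕₚ.+-0-commutativeMonoid

-- By definition, μ n = if squareful n then + 0 else -1ℤ ℤ.^ primeDivisorCount n.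
squareful : ℕ → Bool
squareful n = any (λ d → does (d * d ∣? n)) (applyUpTo (λ i → suc (suc i)) n)

primeDivisorCount : ℕ → ℕ
primeDivisorCount n = length (filter (λ p → prime? p ×-dec p ∣? n) (upTo (suc n)))

squareful-intro : ∀ {d n} .{{_ : NonZero n}} → 2 ≤ d → d * d ∣ n → T (squareful n)
squareful-intro {d@(suc (suc d′))} {n} (s≤s (s≤s _)) d²∣n =
  any⁺ (λ d → does (d * d ∣? n)) (lose (∈-applyUpTo⁺ (λ i → suc (suc i)) d′<n) (T-does⁺ (d * d ∣? n) d²∣n))
  where
  d′<n : d′ < n
  d′<n = ℕₚ.≤-trans (ℕₚ.n≤1+n (suc d′)) (ℕₚ.≤-trans (ℕₚ.m≤m*n d d) (∣⇒≤ d²∣n))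

squareful-elim : ∀ {n} → T (squareful n) → ∃[ d ] (suc (suc d) * suc (suc d) ∣ n)
squareful-elim {n} sq with find (any⁻ (λ d → does (d * d ∣? n)) (applyUpTo (λ i → suc (suc i)) n) sq)
... | _ , d∈ , d²∣n with ∈-applyUpTo⁻ (λ i → suc (suc i)) d∈
...   | i , _ , refl = i , T-does⁻ (suc (suc i) * suc (suc i) ∣? n) d²∣n

squareful-p* : ∀ {p m} .{{_ : NonZero m}} → Prime p → ¬ p ∣ m → squareful (p * m) ≡ squareful m
squareful-p* {p} {m} p-prime p∤m = T-injective from-pm to-pm
  where
  instance
    p≢0 : NonZero p
    p≢0 = prime⇒nonZero p-prime
    pm≢0 : NonZero (p * m)
    pm≢0 = ℕₚ.m*n≢0 p m
  from-pm : T (squareful (p * m)) → T (squareful m)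
  from-pm sq with squareful-elim sq
  ... | d′ , d²∣pm = squareful-intro (s≤s (s≤s z≤n)) (coprime-divisor (prime∤⇒coprime p-prime p∤d²) d²∣pm)
    where
    p∤d² : ¬ p ∣ suc (suc d′) * suc (suc d′)
    p∤d² p∣d² = p∤m (*-cancelˡ-∣ p (∣-trans (*-pres-∣ p∣d p∣d) d²∣pm))
      where
      p∣d : p ∣ suc (suc d′)
      p∣d = reduce (euclidsLemma (suc (suc d′)) (suc (suc d′)) p-prime p∣d²)
  to-pm : T (squareful m) → T (squareful (p * m))
  to-pm sq with squareful-elim sq
  ... | d′ , d²∣m = squareful-intro (s≤s (s≤s z≤n)) (∣-trans d²∣m (n∣m*n p))

isPrimeDivisor : ℕ → ℕ → ℕ
isPrimeDivisor n q = if does (prime? q ×-dec q ∣? n) then 1 else 0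

length-filter-as-sum : ∀ {p} {P : ℕ → Set p} (P? : Decidable P) xs →
  length (filter P? xs) ≡ sum (map (λ x → if does (P? x) then 1 else 0) xs)
length-filter-as-sum P? []       = refl
length-filter-as-sum P? (x ∷ xs) with does (P? x)
... | true  = cong suc (length-filter-as-sum P? xs)
... | false = length-filter-as-sum P? xs

primeDivisorCount-as-∑ : ∀ n → primeDivisorCount n ≡ ℕ∑.∑ (suc n) (isPrimeDivisor n)
primeDivisorCount-as-∑ n =
  trans (length-filter-as-sum (λ p → prime? p ×-dec p ∣? n) (upTo (suc n))) (ℕ∑.listSum-applyUpTo (suc n) (isPrimeDivisor n) id)

isPrimeDivisor-p* : ∀ {p m} → Prime p → ¬ p ∣ m → ∀ q → isPrimeDivisor (p * m) q ≡ isPrimeDivisor m q ℕ.+ (if does (q ℕ.≟ p) then 1 else 0)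
isPrimeDivisor-p* {p} {m} p-prime p∤m q with q ℕ.≟ p
... | yes refl = trans (if-yes (prime? p ×-dec p ∣? p * m) (p-prime , m∣m*n m))
                       (sym (cong₂ ℕ._+_ (if-no (prime? p ×-dec p ∣? m) (p∤m ∘ proj₂)) (if-yes (p ℕ.≟ p) refl)))
... | no  q≢p  = trans (if-⇔ (prime? q ×-dec q ∣? p * m) (prime? q ×-dec q ∣? m)
                             (λ (q-prime , q∣pm) → q-prime , ∣p*m⇒∣m q-prime q∣pm) (λ (q-prime , q∣m) → q-prime , ∣-trans q∣m (n∣m*n p)))
                       (sym (trans (cong (isPrimeDivisor m q ℕ.+_) (if-no (q ℕ.≟ p) q≢p)) (ℕₚ.+-identityʳ _)))
  where
  ∣p*m⇒∣m : Prime q → q ∣ p * m → q ∣ m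
  ∣p*m⇒∣m q-prime q∣pm with euclidsLemma p m q-prime q∣pm
  ... | inj₂ q∣m = q∣m
  ... | inj₁ q∣p with prime⇒irreducible p-prime q∣p
  ...   | inj₁ refl = ⊥-elim (¬prime[1] q-prime)
  ...   | inj₂ q≡p  = ⊥-elim (q≢p q≡p)

primeDivisorCount-p* : ∀ {p m} .{{_ : NonZero m}} → Prime p → ¬ p ∣ m → primeDivisorCount (p * m) ≡ suc (primeDivisorCount m)
primeDivisorCount-p* {p} {m} p-prime p∤m = begin
  primeDivisorCount (p * m)
    ≡⟨ primeDivisorCount-as-∑ (p * m) ⟩
  ℕ∑.∑ (suc (p * m)) (isPrimeDivisor (p * m))
    ≡⟨ ℕ∑.∑-cong (suc (p * m)) (isPrimeDivisor-p* p-prime p∤m) ⟩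
  ℕ∑.∑ (suc (p * m)) (λ q → isPrimeDivisor m q ℕ.+ (if does (q ℕ.≟ p) then 1 else 0))
    ≡⟨ ℕ∑.∑-distrib-+ (suc (p * m)) _ _ ⟩
  ℕ∑.∑ (suc (p * m)) (isPrimeDivisor m) ℕ.+ ℕ∑.∑ (suc (p * m)) (λ q → if does (q ℕ.≟ p) then 1 else 0)
    ≡⟨ cong₂ ℕ._+_ (ℕ∑.∑-extend (s≤s (ℕₚ.m≤n*m m p)) beyond-m) (ℕ∑.∑-indicator (suc (p * m)) (λ _ → 1) (s≤s (ℕₚ.m≤m*n p m))) ⟩
  ℕ∑.∑ (suc m) (isPrimeDivisor m) ℕ.+ 1
    ≡⟨ ℕₚ.+-comm _ 1 ⟩
  suc (ℕ∑.∑ (suc m) (isPrimeDivisor m))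
    ≡⟨ cong suc (primeDivisorCount-as-∑ m) ⟨
  suc (primeDivisorCount m) ∎
  where
  open ≡.≡-Reasoning
  instance
    p≢0 : NonZero p
    p≢0 = prime⇒nonZero p-prime
  beyond-m : ∀ q → suc m ≤ q → q < suc (p * m) → isPrimeDivisor m q ≡ 0
  beyond-m q m<q _ = if-no (prime? q ×-dec q ∣? m) (>⇒∤ m<q ∘ proj₂)

μ-p*-divisible : ∀ {p m} .{{_ : NonZero m}} → Prime p → p ∣ m → μ (p * m) ≡ + 0
μ-p*-divisible {p} {m} p-prime p∣m =
  if-true (squareful-intro ⦃ ℕₚ.m*n≢0 p m ⦃ prime⇒nonZero p-prime ⦄ ⦄ (prime⇒2≤ p-prime) (*-monoʳ-∣ p p∣m))

μ-p*-coprime : ∀ {p m} .{{_ : NonZero m}} → Prime p → ¬ p ∣ m → μ (p * m) ≡ ℤ.- μ m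
μ-p*-coprime {p} {m} p-prime p∤m =
  trans (cong₂ (λ b c → if b then + 0 else -1ℤ ℤ.^ c) (squareful-p* p-prime p∤m) (primeDivisorCount-p* p-prime p∤m))
        (negate (squareful m))
  where
  negate : ∀ b → (if b then + 0 else -1ℤ ℤ.^ suc (primeDivisorCount m)) ≡ ℤ.- (if b then + 0 else -1ℤ ℤ.^ primeDivisorCount m)
  negate true  = refl
  negate false = ℤₚ.-1*i≡-i _

μ-p^1≡-1 : ∀ {p} → Prime p → μ (p ^ 1) ≡ -1ℤ
μ-p^1≡-1 p-prime = μ-p*-coprime p-prime (prime∤1 p-prime)

μ-p^[2+k]≡0 : ∀ {p} k → Prime p → μ (p ^ suc (suc k)) ≡ + 0
μ-p^[2+k]≡0 {p} k p-prime = μ-p*-divisible ⦃ ℕₚ.m^n≢0 p (suc k) ⦃ prime⇒nonZero p-prime ⦄ ⦄ p-prime (m∣m*n (p ^ k))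

μ-p^k*-multiplicative : ∀ {p m} k .{{_ : NonZero m}} → Prime p → ¬ p ∣ m → μ (p ^ k * m) ≡ μ (p ^ k) ℤ.* μ m
μ-p^k*-multiplicative {p} {m} zero p-prime p∤m = trans (cong μ (ℕₚ.*-identityˡ m)) (sym (ℤₚ.*-identityˡ (μ m)))
μ-p^k*-multiplicative {p} {m} 1 p-prime p∤m = begin
  μ (p * 1 * m)      ≡⟨ cong (λ x → μ (x * m)) (ℕₚ.*-identityʳ p) ⟩
  μ (p * m)          ≡⟨ μ-p*-coprime p-prime p∤m ⟩
  ℤ.- μ m            ≡⟨ ℤₚ.-1*i≡-i (μ m) ⟨
  -1ℤ ℤ.* μ m        ≡⟨ cong (ℤ._* μ m) (μ-p^1≡-1 p-prime) ⟨
  μ (p ^ 1) ℤ.* μ m  ∎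
  where open ≡.≡-Reasoning
μ-p^k*-multiplicative {p} {m} (suc (suc k)) p-prime p∤m = begin
  μ (p ^ suc (suc k) * m)      ≡⟨ cong μ (ℕₚ.*-assoc p (p ^ suc k) m) ⟩
  μ (p * (p ^ suc k * m))      ≡⟨ μ-p*-divisible ⦃ pᵏ⁺¹m≢0 ⦄ p-prime (∣-trans (m∣m*n (p ^ k)) (m∣m*n m)) ⟩
  + 0                          ≡⟨ cong (ℤ._* μ m) (μ-p^[2+k]≡0 k p-prime) ⟨
  μ (p ^ suc (suc k)) ℤ.* μ m  ∎
  where
  open ≡.≡-Reasoning
  pᵏ⁺¹m≢0 : NonZero (p ^ suc k * m)
  pᵏ⁺¹m≢0 = ℕₚ.m*n≢0 (p ^ suc k) m ⦃ ℕₚ.m^n≢0 p (suc k) ⦃ prime⇒nonZero p-prime ⦄ ⦄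

-- Euler's totient

coprimeTo : ℕ → ℕ → ℕ
coprimeTo n k = if does (coprime? k n) then 1 else 0

-- φ n counts the 1 ≤ k ≤ n coprime to n; as k = 0 and k = n behave alike, the range may start at 0.
φ-as-∑ : ∀ n → φ n ≡ ℕ∑.∑ n (coprimeTo n)
φ-as-∑ n = trans (trans (length-filter-as-sum (λ k → coprime? k n) (applyUpTo suc n)) (ℕ∑.listSum-applyUpTo n (coprimeTo n) suc))
                 (ℕₚ.+-cancelˡ-≡ (coprimeTo n 0) _ _ rotate)
  where
  open ≡.≡-Reasoning
  0≡n : coprimeTo n 0 ≡ coprimeTo n n
  0≡n = if-⇔ (coprime? 0 n) (coprime? n n) (λ c {d} (d∣n , _) → c (d ∣0 , d∣n)) (λ c (_ , d∣n) → c (d∣n , d∣n))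
  rotate : coprimeTo n 0 ℕ.+ ℕ∑.∑ n (coprimeTo n ∘ suc) ≡ coprimeTo n 0 ℕ.+ ℕ∑.∑ n (coprimeTo n)
  rotate = begin
    coprimeTo n 0 ℕ.+ ℕ∑.∑ n (coprimeTo n ∘ suc)  ≡⟨ ℕ∑.∑-suc-front n (coprimeTo n) ⟨
    ℕ∑.∑ n (coprimeTo n) ℕ.+ coprimeTo n n        ≡⟨ ℕₚ.+-comm _ (coprimeTo n n) ⟩
    coprimeTo n n ℕ.+ ℕ∑.∑ n (coprimeTo n)        ≡⟨ cong (ℕ._+ ℕ∑.∑ n (coprimeTo n)) 0≡n ⟨
    coprimeTo n 0 ℕ.+ ℕ∑.∑ n (coprimeTo n)        ∎

∑-periodic : ∀ x c (f : ℕ → ℕ) → (∀ i → f (x ℕ.+ i) ≡ f i) → ℕ∑.∑ (c * x) f ≡ c * ℕ∑.∑ x f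
∑-periodic x zero    f periodic = refl
∑-periodic x (suc c) f periodic =
  trans (ℕ∑.∑-+ x (c * x) f) (cong (ℕ∑.∑ x f ℕ.+_) (trans (ℕ∑.∑-cong (c * x) periodic) (∑-periodic x c f periodic)))

coprimeTo-periodic : ∀ x i → coprimeTo x (x ℕ.+ i) ≡ coprimeTo x i
coprimeTo-periodic x i = if-⇔ (coprime? (x ℕ.+ i) x) (coprime? i x) (λ c (d∣i , d∣x) → c (∣m∣n⇒∣m+n d∣x d∣i , d∣x)) coprime-+

module _ {p} (p-prime : Prime p) where

  private instance
    p≢0 : NonZero p
    p≢0 = prime⇒nonZero p-prime

  φ-p*-divisible : ∀ {x} → p ∣ x → φ (p * x) ≡ p * φ x
  φ-p*-divisible {x} p∣x = begin
    φ (p * x)                         ≡⟨ φ-as-∑ (p * x) ⟩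
    ℕ∑.∑ (p * x) (coprimeTo (p * x))  ≡⟨ ℕ∑.∑-cong (p * x) same ⟩
    ℕ∑.∑ (p * x) (coprimeTo x)        ≡⟨ ∑-periodic x p (coprimeTo x) (coprimeTo-periodic x) ⟩
    p * ℕ∑.∑ x (coprimeTo x)          ≡⟨ cong (p *_) (φ-as-∑ x) ⟨
    p * φ x                           ∎
    where
    open ≡.≡-Reasoning
    same : ∀ k → coprimeTo (p * x) k ≡ coprimeTo x k
    same k = if-⇔ (coprime? k (p * x)) (coprime? k x)
      (λ c (d∣k , d∣x) → c (d∣k , ∣-trans d∣x (n∣m*n p)))
      (λ c → coprime-* (λ (d∣k , d∣p) → c (d∣k , ∣-trans d∣p p∣x)) c)

  -- Among 0 ≤ k < p·x, the k coprime to x are those coprime to p·x and the multiples p·j of p with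
  -- j coprime to x.
  φ-p*-complement : ∀ {x} → ¬ p ∣ x → φ (p * x) ℕ.+ φ x ≡ p * φ x
  φ-p*-complement {x} p∤x = sym (begin
    p * φ x                                                        ≡⟨ cong (p *_) (φ-as-∑ x) ⟩
    p * ℕ∑.∑ x (coprimeTo x)                                       ≡⟨ ∑-periodic x p (coprimeTo x) (coprimeTo-periodic x) ⟨
    ℕ∑.∑ (p * x) (coprimeTo x)                                     ≡⟨ ℕ∑.∑-cong (p * x) split ⟩
    ℕ∑.∑ (p * x) (λ k → coprimeTo (p * x) k ℕ.+ multipleOfP k)     ≡⟨ ℕ∑.∑-distrib-+ (p * x) (coprimeTo (p * x)) multipleOfP ⟩
    ℕ∑.∑ (p * x) (coprimeTo (p * x)) ℕ.+ ℕ∑.∑ (p * x) multipleOfP  ≡⟨ cong₂ ℕ._+_ (φ-as-∑ (p * x)) (sym multiples) ⟨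
    φ (p * x) ℕ.+ φ x                                              ∎)
    where
    open ≡.≡-Reasoning
    multipleOfP : ℕ → ℕ
    multipleOfP k = if does (p ∣? k) then coprimeTo x k else 0
    split : ∀ k → coprimeTo x k ≡ coprimeTo (p * x) k ℕ.+ multipleOfP k
    split k with p ∣? k
    ... | yes p∣k = cong (ℕ._+ coprimeTo x k) (sym (if-no (coprime? k (p * x)) (λ c → prime∤1 p-prime (≡.subst (p ∣_) (c (p∣k , m∣m*n x)) ∣-refl))))
    ... | no  p∤k = trans (if-⇔ (coprime? k x) (coprime? k (p * x)) (coprime-* (prime∤⇒coprime p-prime p∤k))
                                (λ c (d∣k , d∣x) → c (d∣k , ∣-trans d∣x (n∣m*n p))))
                          (sym (ℕₚ.+-identityʳ _))
    multiples : ℕ∑.∑ (p * x) multipleOfP ≡ φ x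
    multiples = begin
      ℕ∑.∑ (p * x) multipleOfP             ≡⟨ ℕ∑.∑-multiples p x (coprimeTo x) ⟩
      ℕ∑.∑ x (λ j → coprimeTo x (p * j))   ≡⟨ ℕ∑.∑-cong x (λ j → if-⇔ (coprime? (p * j) x) (coprime? j x)
                                               (λ c (d∣j , d∣x) → c (∣-trans d∣j (n∣m*n p) , d∣x))
                                               (λ c → Coprimality.sym (coprime-* (prime∤⇒coprime p-prime p∤x) (Coprimality.sym c)))) ⟩
      ℕ∑.∑ x (coprimeTo x)                 ≡⟨ φ-as-∑ x ⟨
      φ x                                  ∎

  φ-p*-coprime : ∀ {x} → ¬ p ∣ x → φ (p * x) ≡ (p ∸ 1) * φ x
  φ-p*-coprime {x} p∤x = begin
    φ (p * x)                ≡⟨ ℕₚ.m+n∸n≡m (φ (p * x)) (φ x) ⟨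
    φ (p * x) ℕ.+ φ x ∸ φ x  ≡⟨ cong (_∸ φ x) (φ-p*-complement p∤x) ⟩
    p * φ x ∸ φ x            ≡⟨ cong (p * φ x ∸_) (ℕₚ.*-identityˡ (φ x)) ⟨
    p * φ x ∸ 1 * φ x        ≡⟨ ℕₚ.*-distribʳ-∸ (φ x) p 1 ⟨
    (p ∸ 1) * φ x            ∎
    where open ≡.≡-Reasoning

  φ-p*-∣ : ∀ x → φ x ∣ φ (p * x)
  φ-p*-∣ x with p ∣? x
  ... | yes p∣x = ≡.subst (φ x ∣_) (sym (φ-p*-divisible p∣x)) (n∣m*n p)
  ... | no  p∤x = divides (p ∸ 1) (φ-p*-coprime p∤x)

  φ-p^[1+k]* : ∀ {m} k → ¬ p ∣ m → φ (p ^ suc k * m) ≡ p ^ k * ((p ∸ 1) * φ m)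
  φ-p^[1+k]* {m} zero p∤m = trans (cong (λ y → φ (y * m)) (ℕₚ.*-identityʳ p)) (trans (φ-p*-coprime p∤m) (sym (ℕₚ.*-identityˡ _)))
  φ-p^[1+k]* {m} (suc k) p∤m = begin
    φ (p ^ suc (suc k) * m)        ≡⟨ cong φ (ℕₚ.*-assoc p (p ^ suc k) m) ⟩
    φ (p * (p ^ suc k * m))        ≡⟨ φ-p*-divisible (∣-trans (m∣m*n (p ^ k)) (m∣m*n m)) ⟩
    p * φ (p ^ suc k * m)          ≡⟨ cong (p *_) (φ-p^[1+k]* k p∤m) ⟩
    p * (p ^ k * ((p ∸ 1) * φ m))  ≡⟨ ℕₚ.*-assoc p (p ^ k) _ ⟨
    p ^ suc k * ((p ∸ 1) * φ m)    ∎
    where open ≡.≡-Reasoning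

  φ-p^[1+k] : ∀ k → φ (p ^ suc k) ≡ p ^ k * (p ∸ 1)
  φ-p^[1+k] k = begin
    φ (p ^ suc k)          ≡⟨ cong φ (ℕₚ.*-identityʳ (p ^ suc k)) ⟨
    φ (p ^ suc k * 1)      ≡⟨ φ-p^[1+k]* k (prime∤1 p-prime) ⟩
    p ^ k * ((p ∸ 1) * 1)  ≡⟨ cong (p ^ k *_) (ℕₚ.*-identityʳ (p ∸ 1)) ⟩
    p ^ k * (p ∸ 1)        ∎
    where open ≡.≡-Reasoning

  φ-p^k*-multiplicative : ∀ {m} k → ¬ p ∣ m → φ (p ^ k * m) ≡ φ (p ^ k) * φ m
  φ-p^k*-multiplicative {m} zero    p∤m = trans (cong φ (ℕₚ.*-identityˡ m)) (sym (ℕₚ.*-identityˡ (φ m)))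
  φ-p^k*-multiplicative {m} (suc k) p∤m = begin
    φ (p ^ suc k * m)        ≡⟨ φ-p^[1+k]* k p∤m ⟩
    p ^ k * ((p ∸ 1) * φ m)  ≡⟨ ℕₚ.*-assoc (p ^ k) (p ∸ 1) (φ m) ⟨
    p ^ k * (p ∸ 1) * φ m    ≡⟨ cong (_* φ m) (φ-p^[1+k] k) ⟨
    φ (p ^ suc k) * φ m      ∎
    where open ≡.≡-Reasoning

φ-∣-φ-* : ∀ x k .{{_ : NonZero k}} → φ x ∣ φ (k * x)
φ-∣-φ-* x k = ≡.subst (λ y → φ x ∣ φ (y * x)) (sym (PrimeFactorisation.isFactorisation (factorise k)))
                      (over-primes (factors (factorise k)) (PrimeFactorisation.factorsPrime (factorise k)))
  where
  over-primes : ∀ qs → All Prime qs → φ x ∣ φ (product qs * x)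
  over-primes []       []                   = ≡.subst (λ y → φ x ∣ φ y) (sym (ℕₚ.+-identityʳ x)) ∣-refl
  over-primes (q ∷ qs) (q-prime ∷ qs-prime) =
    ≡.subst (λ y → φ x ∣ φ y) (sym (ℕₚ.*-assoc q (product qs) x)) (∣-trans (over-primes qs qs-prime) (φ-p*-∣ q-prime (product qs * x)))

φ-∣ : ∀ {d n} .{{_ : NonZero n}} → d ∣ n → φ d ∣ φ n
φ-∣ {d} (divides k refl) = φ-∣-φ-* d k ⦃ ℕₚ.m*n≢0⇒m≢0 k ⦄

φ-nonZero : ∀ n .{{_ : NonZero n}} → NonZero (φ n)
φ-nonZero (suc n) = ≡.subst NonZero (sym (cong length (filter-accept (λ k → coprime? k (suc n)) (1-coprimeTo (suc n))))) _

-- The exponents a_M(t) at prime powers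

∑-*ʳ : ∀ n (f : ℕ → ℤ) c → ℤ∑.∑ n (λ i → f i ℤ.* c) ≡ ℤ∑.∑ n f ℤ.* c
∑-*ʳ n f c = ℤ∑.∑-homo {ℤ._* c} (λ x y → ℤₚ.*-distribʳ-+ c x y) (ℤₚ.*-zeroˡ c) n f

divisorSum-*ˡ : ∀ M c (G : ℕ → ℤ) → ℤ∑.divisorSum M (λ r → c ℤ.* G r) ≡ c ℤ.* ℤ∑.divisorSum M G
divisorSum-*ˡ M c G = ℤ∑.divisorSum-homo {c ℤ.*_} (ℤₚ.*-distribˡ-+ c) (ℤₚ.*-zeroʳ c) M G

aTerm : ℕ → ℕ → ℕ → ℤ
aTerm M t r = μ (t div r) ℤ.* μ (M div r) ℤ.* + (φ M div φ (M div r))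

δ : ℕ → ℕ → ℤ
δ j k = if does (j ℕ.≟ k) then + 1 else + 0

module _ {p} (p-prime : Prime p) where

  private instance
    p≢0 : NonZero p
    p≢0 = prime⇒nonZero p-prime

  p^-split : ∀ {i j} → i ≤ j → p ^ j ≡ p ^ i * p ^ (j ∸ i)
  p^-split {i} {j} i≤j = trans (cong (p ^_) (sym (ℕₚ.m+[n∸m]≡n i≤j))) (ℕₚ.^-distribˡ-+-* p i (j ∸ i))

  p^-∣-p^ : ∀ {i j} → i ≤ j → p ^ i ∣ p ^ j
  p^-∣-p^ {i} {j} i≤j = divides (p ^ (j ∸ i)) (trans (p^-split i≤j) (ℕₚ.*-comm (p ^ i) _))

  p^-div-p^ : ∀ {i j} → i ≤ j → (p ^ j) div (p ^ i) ≡ p ^ (j ∸ i)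
  p^-div-p^ {i} {j} i≤j = begin
    (p ^ j) div (p ^ i)                     ≡⟨ cong (_div (p ^ i)) (trans (p^-split i≤j) (ℕₚ.*-comm (p ^ i) _)) ⟩
    (p ^ (j ∸ i) * p ^ i) div (p ^ i)       ≡⟨ div-as-/ _ (p ^ i) ⦃ pⁱ≢0 ⦄ ⟩
    (p ^ (j ∸ i) * p ^ i / p ^ i) ⦃ pⁱ≢0 ⦄  ≡⟨ m*n/n≡m (p ^ (j ∸ i)) (p ^ i) ⦃ pⁱ≢0 ⦄ ⟩
    p ^ (j ∸ i)                             ∎
    where
    open ≡.≡-Reasoning
    pⁱ≢0 : NonZero (p ^ i)
    pⁱ≢0 = ℕₚ.m^n≢0 p i

  p^*-div-p^* : ∀ {i j t r} .{{_ : NonZero r}} → i ≤ j → r ∣ t → (p ^ j * t) div (p ^ i * r) ≡ p ^ (j ∸ i) * (t div r)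
  p^*-div-p^* {i} {j} i≤j r∣t = trans (div-* ⦃ ℕₚ.m^n≢0 p i ⦄ (p^-∣-p^ i≤j) r∣t) (cong (_* _) (p^-div-p^ i≤j))

  φ-p^*-quotient : ∀ {m X} n k .{{_ : NonZero m}} → ¬ p ∣ m → X ∣ m → k ≤ n →
    φ (p ^ n * m) div φ (p ^ k * X) ≡ φ (p ^ n) div φ (p ^ k) * (φ m div φ X)
  φ-p^*-quotient {m} {X} n k p∤m X∣m k≤n = begin
    φ (p ^ n * m) div φ (p ^ k * X)                ≡⟨ cong₂ _div_ (φ-p^k*-multiplicative p-prime n p∤m)
                                                                  (φ-p^k*-multiplicative p-prime k (λ p∣X → p∤m (∣-trans p∣X X∣m))) ⟩
    (φ (p ^ n) * φ m) div (φ (p ^ k) * φ X)        ≡⟨ div-* ⦃ φ-nonZero (p ^ k) ⦃ ℕₚ.m^n≢0 p k ⦄ ⦄ ⦃ φ-nonZero X ⦃ ∣⇒nonZero X∣m ⦄ ⦄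
                                                            (φ-∣ ⦃ ℕₚ.m^n≢0 p n ⦄ (p^-∣-p^ k≤n)) (φ-∣ X∣m) ⟩
    φ (p ^ n) div φ (p ^ k) * (φ m div φ X)        ∎
    where open ≡.≡-Reasoning

  aTerm-p^ : ∀ {n j i} → i ≤ j → i ≤ n →
    aTerm (p ^ n) (p ^ j) (p ^ i) ≡ μ (p ^ (j ∸ i)) ℤ.* μ (p ^ (n ∸ i)) ℤ.* + (φ (p ^ n) div φ (p ^ (n ∸ i)))
  aTerm-p^ {n} i≤j i≤n = cong₂ (λ x y → μ x ℤ.* μ y ℤ.* + (φ (p ^ n) div φ y)) (p^-div-p^ i≤j) (p^-div-p^ i≤n)

  aTerm-multiplicative : ∀ {m t r} n j i .{{_ : NonZero m}} → ¬ p ∣ m → r ∣ t → t ∣ m → i ≤ j → j ≤ n →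
    aTerm (p ^ n * m) (p ^ j * t) (p ^ i * r) ≡ aTerm (p ^ n) (p ^ j) (p ^ i) ℤ.* aTerm m t r
  aTerm-multiplicative {m} {t} {r} n j i p∤m r∣t t∣m i≤j j≤n = begin
    aTerm (p ^ n * m) (p ^ j * t) (p ^ i * r)
      ≡⟨ cong₂ (λ x y → μ x ℤ.* μ y ℤ.* + (φ (p ^ n * m) div φ y)) (p^*-div-p^* i≤j r∣t) (p^*-div-p^* i≤n r∣m) ⟩
    μ (p ^ (j ∸ i) * E) ℤ.* μ (p ^ (n ∸ i) * X) ℤ.* + (φ (p ^ n * m) div φ (p ^ (n ∸ i) * X))
      ≡⟨ cong₂ (λ x y → x ℤ.* y ℤ.* + (φ (p ^ n * m) div φ (p ^ (n ∸ i) * X)))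
               (μ-p^k*-multiplicative (j ∸ i) ⦃ ∣⇒nonZero E∣m ⦄ p-prime (λ p∣E → p∤m (∣-trans p∣E E∣m)))
               (μ-p^k*-multiplicative (n ∸ i) ⦃ ∣⇒nonZero X∣m ⦄ p-prime (λ p∣X → p∤m (∣-trans p∣X X∣m))) ⟩
    μᵖ (j ∸ i) ℤ.* μ E ℤ.* (μᵖ (n ∸ i) ℤ.* μ X) ℤ.* + (φ (p ^ n * m) div φ (p ^ (n ∸ i) * X))
      ≡⟨ cong (λ z → μᵖ (j ∸ i) ℤ.* μ E ℤ.* (μᵖ (n ∸ i) ℤ.* μ X) ℤ.* + z) (φ-p^*-quotient n (n ∸ i) p∤m X∣m (ℕₚ.m∸n≤m n i)) ⟩
    μᵖ (j ∸ i) ℤ.* μ E ℤ.* (μᵖ (n ∸ i) ℤ.* μ X) ℤ.* + (φ (p ^ n) div φ (p ^ (n ∸ i)) * (φ m div φ X))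
      ≡⟨ cong (μᵖ (j ∸ i) ℤ.* μ E ℤ.* (μᵖ (n ∸ i) ℤ.* μ X) ℤ.*_) (ℤₚ.pos-* (φ (p ^ n) div φ (p ^ (n ∸ i))) (φ m div φ X)) ⟩
    μᵖ (j ∸ i) ℤ.* μ E ℤ.* (μᵖ (n ∸ i) ℤ.* μ X) ℤ.* (+ (φ (p ^ n) div φ (p ^ (n ∸ i))) ℤ.* + (φ m div φ X))
      ≡⟨ regroup (μᵖ (j ∸ i)) (μ E) (μᵖ (n ∸ i)) (μ X) _ _ ⟩
    μᵖ (j ∸ i) ℤ.* μᵖ (n ∸ i) ℤ.* + (φ (p ^ n) div φ (p ^ (n ∸ i))) ℤ.* aTerm m t r
      ≡⟨ cong (ℤ._* aTerm m t r) (aTerm-p^ i≤j i≤n) ⟨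
    aTerm (p ^ n) (p ^ j) (p ^ i) ℤ.* aTerm m t r ∎
    where
    open ≡.≡-Reasoning
    i≤n : i ≤ n
    i≤n = ℕₚ.≤-trans i≤j j≤n
    r∣m : r ∣ m
    r∣m = ∣-trans r∣t t∣m
    instance
      r≢0 : NonZero r
      r≢0 = ∣⇒nonZero r∣m
    E X : ℕ
    E = t div r
    X = m div r
    E∣m : E ∣ m
    E∣m = ∣-trans (div-∣ r∣t) t∣m
    X∣m : X ∣ m
    X∣m = div-∣ r∣m
    μᵖ : ℕ → ℤ
    μᵖ k = μ (p ^ k)
    regroup : ∀ a e b x f g → a ℤ.* e ℤ.* (b ℤ.* x) ℤ.* (f ℤ.* g) ≡ a ℤ.* b ℤ.* f ℤ.* (e ℤ.* x ℤ.* g)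
    regroup = solve-∀

  a-p^-as-∑ : ∀ n j → a (p ^ n) (p ^ j) ≡ ℤ∑.∑ (suc j) (λ i → aTerm (p ^ n) (p ^ j) (p ^ i))
  a-p^-as-∑ n j = begin
    a (p ^ n) (p ^ j)                                           ≡⟨ ℤ∑.listSum-divisors (p ^ j) ⦃ ℕₚ.m^n≢0 p j ⦄ G ⟩
    ℤ∑.divisorSum (p ^ j) G                                     ≡⟨ cong (λ x → ℤ∑.divisorSum x G) (ℕₚ.*-identityʳ (p ^ j)) ⟨
    ℤ∑.divisorSum (p ^ j * 1) G                                 ≡⟨ ℤ∑.divisorSum-p^j* p-prime (prime∤1 p-prime) j G ⟩
    ℤ∑.∑ (suc j) (λ i → ℤ∑.divisorSum 1 (λ r → G (p ^ i * r)))  ≡⟨ ℤ∑.∑-cong (suc j) (λ i → ℤ∑.divisorSum-1 (λ r → G (p ^ i * r))) ⟩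
    ℤ∑.∑ (suc j) (λ i → G (p ^ i * 1))                          ≡⟨ ℤ∑.∑-cong (suc j) (λ i → cong G (ℕₚ.*-identityʳ (p ^ i))) ⟩
    ℤ∑.∑ (suc j) (λ i → G (p ^ i))                              ∎
    where
    open ≡.≡-Reasoning
    G : ℕ → ℤ
    G = aTerm (p ^ n) (p ^ j)

  a-multiplicative : ∀ {m t} n j .{{_ : NonZero m}} → ¬ p ∣ m → t ∣ m → j ≤ n →
    a (p ^ n * m) (p ^ j * t) ≡ a (p ^ n) (p ^ j) ℤ.* a m t
  a-multiplicative {m} {t} n j p∤m t∣m j≤n = begin
    a (p ^ n * m) (p ^ j * t)                                   ≡⟨ ℤ∑.listSum-divisors (p ^ j * t) ⦃ ℕₚ.m*n≢0 (p ^ j) t ⦃ ℕₚ.m^n≢0 p j ⦄ ⦄ G ⟩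
    ℤ∑.divisorSum (p ^ j * t) G                                 ≡⟨ ℤ∑.divisorSum-p^j* p-prime p∤t j G ⟩
    ℤ∑.∑ (suc j) (λ i → ℤ∑.divisorSum t (λ r → G (p ^ i * r)))  ≡⟨ ℤ∑.∑-cong-< (suc j) factorise-terms ⟩
    ℤ∑.∑ (suc j) (λ i → A i ℤ.* ℤ∑.divisorSum t (aTerm m t))    ≡⟨ ℤ∑.∑-cong (suc j) (λ i → cong (A i ℤ.*_) (ℤ∑.listSum-divisors t (aTerm m t))) ⟨
    ℤ∑.∑ (suc j) (λ i → A i ℤ.* a m t)                          ≡⟨ ∑-*ʳ (suc j) A (a m t) ⟩
    ℤ∑.∑ (suc j) A ℤ.* a m t                                    ≡⟨ cong (ℤ._* a m t) (a-p^-as-∑ n j) ⟨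
    a (p ^ n) (p ^ j) ℤ.* a m t                                 ∎
    where
    open ≡.≡-Reasoning
    instance
      t≢0 : NonZero t
      t≢0 = ∣⇒nonZero t∣m
    p∤t : ¬ p ∣ t
    p∤t p∣t = p∤m (∣-trans p∣t t∣m)
    G : ℕ → ℤ
    G = aTerm (p ^ n * m) (p ^ j * t)
    A : ℕ → ℤ
    A i = aTerm (p ^ n) (p ^ j) (p ^ i)
    factorise-terms : ∀ i → i < suc j → ℤ∑.divisorSum t (λ r → G (p ^ i * r)) ≡ A i ℤ.* ℤ∑.divisorSum t (aTerm m t)
    factorise-terms i i<1+j = trans (ℤ∑.divisorSum-cong t (λ r r∣t → aTerm-multiplicative n j i p∤m r∣t t∣m (ℕₚ.≤-pred i<1+j) j≤n))
                                    (divisorSum-*ˡ t (A i) (aTerm m t))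

  aTerm-p^≡0 : ∀ {n j i} → i ≤ j → 2 ℕ.+ i ≤ n → aTerm (p ^ n) (p ^ j) (p ^ i) ≡ + 0
  aTerm-p^≡0 {n} {j} {i} i≤j 2+i≤n = begin
    aTerm (p ^ n) (p ^ j) (p ^ i)   ≡⟨ aTerm-p^ i≤j (ℕₚ.m+n≤o⇒n≤o 2 2+i≤n) ⟩
    μʲ ℤ.* μ (p ^ (n ∸ i)) ℤ.* Φ    ≡⟨ cong (λ x → μʲ ℤ.* μ (p ^ x) ℤ.* Φ) (sym (ℕₚ.m+[n∸m]≡n 2≤n∸i)) ⟩
    μʲ ℤ.* μ (p ^ (2 ℕ.+ k)) ℤ.* Φ  ≡⟨ cong (λ x → μʲ ℤ.* x ℤ.* Φ) (μ-p^[2+k]≡0 k p-prime) ⟩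
    μʲ ℤ.* + 0 ℤ.* Φ                ≡⟨ cong (ℤ._* Φ) (ℤₚ.*-zeroʳ μʲ) ⟩
    + 0                             ∎
    where
    open ≡.≡-Reasoning
    μʲ Φ : ℤ
    μʲ = μ (p ^ (j ∸ i))
    Φ = + (φ (p ^ n) div φ (p ^ (n ∸ i)))
    2≤n∸i : 2 ≤ n ∸ i
    2≤n∸i = ℕₚ.m+n≤o⇒m≤o∸n 2 2+i≤n
    k : ℕ
    k = n ∸ i ∸ 2

  a-p^j≡0 : ∀ {n j} → 2 ℕ.+ j ≤ n → a (p ^ n) (p ^ j) ≡ + 0
  a-p^j≡0 {n} {j} 2+j≤n = trans (a-p^-as-∑ n j) (ℤ∑.∑-zero (suc j) vanish)
    where
    vanish : ∀ i → i < suc j → aTerm (p ^ n) (p ^ j) (p ^ i) ≡ + 0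
    vanish i i<1+j = aTerm-p^≡0 (ℕₚ.≤-pred i<1+j) (ℕₚ.≤-trans (ℕₚ.+-monoʳ-≤ 2 (ℕₚ.≤-pred i<1+j)) 2+j≤n)

  φ-p^[1+n]-div-φ-p : ∀ n → φ (p ^ suc n) div φ (p ^ 1) ≡ p ^ n
  φ-p^[1+n]-div-φ-p n = begin
    φ (p ^ suc n) div φ (p ^ 1)            ≡⟨ cong₂ _div_ (φ-p^[1+k] p-prime n) (trans (φ-p^[1+k] p-prime 0) (ℕₚ.*-identityˡ (p ∸ 1))) ⟩
    (p ^ n * (p ∸ 1)) div (p ∸ 1)          ≡⟨ div-as-/ _ (p ∸ 1) ⦃ p-1≢0 ⦄ ⟩
    (p ^ n * (p ∸ 1) / (p ∸ 1)) ⦃ p-1≢0 ⦄  ≡⟨ m*n/n≡m (p ^ n) (p ∸ 1) ⦃ p-1≢0 ⦄ ⟩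
    p ^ n                                  ∎
    where
    open ≡.≡-Reasoning
    p-1≢0 : NonZero (p ∸ 1)
    p-1≢0 = ℕ.>-nonZero (ℕₚ.m<n⇒0<n∸m (prime⇒2≤ p-prime))

  ∑-aTerm-p^[1+n]≡0 : ∀ n {j} → n ≤ j → ℤ∑.∑ n (λ i → aTerm (p ^ suc n) (p ^ j) (p ^ i)) ≡ + 0
  ∑-aTerm-p^[1+n]≡0 n n≤j = ℤ∑.∑-zero n (λ i i<n → aTerm-p^≡0 (ℕₚ.≤-trans (ℕₚ.<⇒≤ i<n) n≤j) (s≤s i<n))

  a-p^[1+n]-p^n : ∀ n → a (p ^ suc n) (p ^ n) ≡ ℤ.- + (p ^ n)
  a-p^[1+n]-p^n n = begin
    a (p ^ suc n) (p ^ n)                    ≡⟨ a-p^-as-∑ (suc n) n ⟩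
    ℤ∑.∑ n A ℤ.+ A n                         ≡⟨ cong (ℤ._+ A n) (∑-aTerm-p^[1+n]≡0 n ℕₚ.≤-refl) ⟩
    + 0 ℤ.+ A n                              ≡⟨ ℤₚ.+-identityˡ (A n) ⟩
    A n                                      ≡⟨ aTerm-p^ ℕₚ.≤-refl (ℕₚ.n≤1+n n) ⟩
    μ (p ^ (n ∸ n)) ℤ.* μ (p ^ (suc n ∸ n)) ℤ.* + (φ (p ^ suc n) div φ (p ^ (suc n ∸ n)))
      ≡⟨ cong₂ (λ x y → μ (p ^ x) ℤ.* μ (p ^ y) ℤ.* + (φ (p ^ suc n) div φ (p ^ y))) (ℕₚ.n∸n≡0 n) (ℕₚ.m+n∸n≡m 1 n) ⟩
    + 1 ℤ.* μ (p ^ 1) ℤ.* + (φ (p ^ suc n) div φ (p ^ 1))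
      ≡⟨ cong₂ (λ x y → + 1 ℤ.* x ℤ.* + y) (μ-p^1≡-1 p-prime) (φ-p^[1+n]-div-φ-p n) ⟩
    + 1 ℤ.* -1ℤ ℤ.* + (p ^ n)                ≡⟨ ℤₚ.-1*i≡-i (+ (p ^ n)) ⟩
    ℤ.- + (p ^ n)                            ∎
    where
    open ≡.≡-Reasoning
    A : ℕ → ℤ
    A i = aTerm (p ^ suc n) (p ^ n) (p ^ i)

  a-p^[1+n]-p^[1+n] : ∀ n → a (p ^ suc n) (p ^ suc n) ≡ + (p ^ suc n)
  a-p^[1+n]-p^[1+n] n = begin
    a (p ^ suc n) (p ^ suc n)                  ≡⟨ a-p^-as-∑ (suc n) (suc n) ⟩
    ℤ∑.∑ n A ℤ.+ A n ℤ.+ A (suc n)             ≡⟨ cong (λ x → x ℤ.+ A n ℤ.+ A (suc n)) (∑-aTerm-p^[1+n]≡0 n (ℕₚ.n≤1+n n)) ⟩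
    + 0 ℤ.+ A n ℤ.+ A (suc n)                  ≡⟨ cong₂ (λ x y → + 0 ℤ.+ x ℤ.+ y) term-n term-1+n ⟩
    + 0 ℤ.+ + (p ^ n) ℤ.+ + φ (p ^ suc n)      ≡⟨ cong (λ x → + 0 ℤ.+ + (p ^ n) ℤ.+ + x) (φ-p^[1+k] p-prime n) ⟩
    + 0 ℤ.+ + (p ^ n) ℤ.+ + (p ^ n * (p ∸ 1))  ≡⟨ cong +_ (q+q[p-1]≡pq (p ^ n)) ⟩
    + (p ^ suc n)                              ∎
    where
    open ≡.≡-Reasoning
    A : ℕ → ℤ
    A i = aTerm (p ^ suc n) (p ^ suc n) (p ^ i)
    term-n : A n ≡ + (p ^ n)
    term-n = begin
      A n                                      ≡⟨ aTerm-p^ (ℕₚ.n≤1+n n) (ℕₚ.n≤1+n n) ⟩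
      μ (p ^ (suc n ∸ n)) ℤ.* μ (p ^ (suc n ∸ n)) ℤ.* + (φ (p ^ suc n) div φ (p ^ (suc n ∸ n)))
        ≡⟨ cong (λ y → μ (p ^ y) ℤ.* μ (p ^ y) ℤ.* + (φ (p ^ suc n) div φ (p ^ y))) (ℕₚ.m+n∸n≡m 1 n) ⟩
      μ (p ^ 1) ℤ.* μ (p ^ 1) ℤ.* + (φ (p ^ suc n) div φ (p ^ 1))
        ≡⟨ cong₂ (λ x y → x ℤ.* x ℤ.* + y) (μ-p^1≡-1 p-prime) (φ-p^[1+n]-div-φ-p n) ⟩
      -1ℤ ℤ.* -1ℤ ℤ.* + (p ^ n)                ≡⟨ ℤₚ.*-identityˡ (+ (p ^ n)) ⟩
      + (p ^ n)                                ∎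
    term-1+n : A (suc n) ≡ + φ (p ^ suc n)
    term-1+n = begin
      A (suc n)                                ≡⟨ aTerm-p^ (ℕₚ.≤-refl {suc n}) (ℕₚ.≤-refl {suc n}) ⟩
      μ (p ^ (n ∸ n)) ℤ.* μ (p ^ (n ∸ n)) ℤ.* + (φ (p ^ suc n) div φ (p ^ (n ∸ n)))
        ≡⟨ cong (λ y → μ (p ^ y) ℤ.* μ (p ^ y) ℤ.* + (φ (p ^ suc n) div φ (p ^ y))) (ℕₚ.n∸n≡0 n) ⟩
      + 1 ℤ.* + 1 ℤ.* + (φ (p ^ suc n) div 1)  ≡⟨ ℤₚ.*-identityˡ _ ⟩
      + (φ (p ^ suc n) div 1)                  ≡⟨ cong +_ (n/1≡n (φ (p ^ suc n))) ⟩
      + φ (p ^ suc n)                          ∎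
    q+q[p-1]≡pq : ∀ q → 0 ℕ.+ q ℕ.+ q * (p ∸ 1) ≡ p * q
    q+q[p-1]≡pq q = begin
      q ℕ.+ q * (p ∸ 1)    ≡⟨ ℕₚ.*-suc q (p ∸ 1) ⟨
      q * suc (p ∸ 1)      ≡⟨ cong (q *_) (ℕₚ.m+[n∸m]≡n (ℕ.>-nonZero⁻¹ p)) ⟩
      q * p                ≡⟨ ℕₚ.*-comm q p ⟩
      p * q                ∎

  a-p^[1+n] : ∀ n {j} → j ≤ suc n → a (p ^ suc n) (p ^ j) ≡ + (p ^ suc n) ℤ.* δ j (suc n) ℤ.- + (p ^ n) ℤ.* δ j n
  a-p^[1+n] n {j} j≤1+n with ℕₚ.<-cmp j n
  ... | tri< j<n _ _ = begin
    a (p ^ suc n) (p ^ j)                                  ≡⟨ a-p^j≡0 (s≤s j<n) ⟩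
    + 0                                                    ≡⟨ zeros (+ (p ^ suc n)) (+ (p ^ n)) ⟩
    + (p ^ suc n) ℤ.* + 0 ℤ.- + (p ^ n) ℤ.* + 0            ≡⟨ cong₂ (λ x y → + (p ^ suc n) ℤ.* x ℤ.- + (p ^ n) ℤ.* y) δ[j,1+n]≡0 δ[j,n]≡0 ⟨
    + (p ^ suc n) ℤ.* δ j (suc n) ℤ.- + (p ^ n) ℤ.* δ j n  ∎
    where
    open ≡.≡-Reasoning
    zeros : ∀ x y → + 0 ≡ x ℤ.* + 0 ℤ.- y ℤ.* + 0
    zeros = solve-∀
    δ[j,1+n]≡0 : δ j (suc n) ≡ + 0
    δ[j,1+n]≡0 = if-no (j ℕ.≟ suc n) (ℕₚ.<⇒≢ (ℕₚ.m<n⇒m<1+n j<n))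
    δ[j,n]≡0 : δ j n ≡ + 0
    δ[j,n]≡0 = if-no (j ℕ.≟ n) (ℕₚ.<⇒≢ j<n)
  ... | tri≈ _ refl _ = begin
    a (p ^ suc n) (p ^ n)                                  ≡⟨ a-p^[1+n]-p^n n ⟩
    ℤ.- + (p ^ n)                                          ≡⟨ below (+ (p ^ suc n)) (+ (p ^ n)) ⟩
    + (p ^ suc n) ℤ.* + 0 ℤ.- + (p ^ n) ℤ.* + 1            ≡⟨ cong₂ (λ x y → + (p ^ suc n) ℤ.* x ℤ.- + (p ^ n) ℤ.* y) δ[n,1+n]≡0 (if-yes (n ℕ.≟ n) refl) ⟨
    + (p ^ suc n) ℤ.* δ n (suc n) ℤ.- + (p ^ n) ℤ.* δ n n  ∎
    where
    open ≡.≡-Reasoning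
    below : ∀ x y → ℤ.- y ≡ x ℤ.* + 0 ℤ.- y ℤ.* + 1
    below = solve-∀
    δ[n,1+n]≡0 : δ n (suc n) ≡ + 0
    δ[n,1+n]≡0 = if-no (n ℕ.≟ suc n) (ℕₚ.<⇒≢ (ℕₚ.n<1+n n))
  ... | tri> _ _ n<j with ℕₚ.≤-antisym j≤1+n n<j
  ...   | refl = begin
    a (p ^ suc n) (p ^ suc n)                                          ≡⟨ a-p^[1+n]-p^[1+n] n ⟩
    + (p ^ suc n)                                                      ≡⟨ diagonal (+ (p ^ suc n)) (+ (p ^ n)) ⟩
    + (p ^ suc n) ℤ.* + 1 ℤ.- + (p ^ n) ℤ.* + 0                        ≡⟨ cong₂ (λ x y → + (p ^ suc n) ℤ.* x ℤ.- + (p ^ n) ℤ.* y)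
                                                                                (if-yes (suc n ℕ.≟ suc n) refl) δ[1+n,n]≡0 ⟨
    + (p ^ suc n) ℤ.* δ (suc n) (suc n) ℤ.- + (p ^ n) ℤ.* δ (suc n) n  ∎
    where
    open ≡.≡-Reasoning
    diagonal : ∀ x y → x ≡ x ℤ.* + 1 ℤ.- y ℤ.* + 0
    diagonal = solve-∀
    δ[1+n,n]≡0 : δ (suc n) n ≡ + 0
    δ[1+n,n]≡0 = if-no (suc n ℕ.≟ n) (ℕₚ.>⇒≢ (ℕₚ.n<1+n n))

-- The exponent of Δ(sz) in ∏_{t ∣ M} Δ(c t z)^(g t) is maybe g 0 (scaledDivisor M c s).
scaledDivisor : ℕ → ℕ → ℕ → Maybe ℕ
scaledDivisor M c s = if does (c ∣? s) then (if does (s div c ∣? M) then just (s div c) else nothing) else nothing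

scaledDivisor-hit : ∀ {M c t} .{{_ : NonZero c}} → t ∣ M → scaledDivisor M c (c * t) ≡ just t
scaledDivisor-hit {M} {c} {t} t∣M = begin
  scaledDivisor M c (c * t)                                              ≡⟨ if-yes (c ∣? c * t) (m∣m*n t) ⟩
  (if does ((c * t) div c ∣? M) then just ((c * t) div c) else nothing)  ≡⟨ cong (λ q → if does (q ∣? M) then just q else nothing) ct/c≡t ⟩
  (if does (t ∣? M) then just t else nothing)                            ≡⟨ if-yes (t ∣? M) t∣M ⟩
  just t                                                                 ∎
  where
  open ≡.≡-Reasoning
  ct/c≡t : (c * t) div c ≡ t
  ct/c≡t = trans (div-as-/ (c * t) c) (ℕₚ.*-cancelˡ-≡ _ t c (m*[n/m]≡n (m∣m*n t)))

scaledDivisor-miss : ∀ {M c s} .{{_ : NonZero c}} → (∀ u → s ≡ c * u → ¬ u ∣ M) → scaledDivisor M c s ≡ nothing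
scaledDivisor-miss {M} {c} {s} no-u with c ∣? s
... | no _    = refl
... | yes c∣s = if-no (s div c ∣? M) (no-u (s div c) (sym (trans (cong (c *_) (div-as-/ s c)) (m*[n/m]≡n c∣s))))

multiplicity-divisors : ∀ M c (f : ℕ → ℕ) s .{{_ : NonZero M}} .{{_ : NonZero c}} →
  multiplicity (divisors M) (c *_) f s ≡ maybe f 0 (scaledDivisor M c s)
multiplicity-divisors M c f s = trans (ℕ∑.listSum-divisors M F) (count (c ∣? s))
  where
  F : ℕ → ℕ
  F t = if does (s ℕ.≟ c * t) then f t else 0
  none : (∀ r → r ∣ M → s ≢ c * r) → ℕ∑.divisorSum M F ≡ maybe f 0 (scaledDivisor M c s)
  none s≢cr = trans (ℕ∑.divisorSum-zero M (λ r r∣M → if-no (s ℕ.≟ c * r) (s≢cr r r∣M)))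
                    (sym (cong (maybe f 0) (scaledDivisor-miss (λ u s≡cu u∣M → s≢cr u u∣M s≡cu))))
  count : Dec (c ∣ s) → ℕ∑.divisorSum M F ≡ maybe f 0 (scaledDivisor M c s)
  count (no c∤s) = none (λ r _ s≡cr → c∤s (divides r (trans s≡cr (ℕₚ.*-comm c r))))
  count (yes (divides q s≡qc)) with q ∣? M
  ... | no  q∤M = none (λ r r∣M s≡cr → q∤M (≡.subst (_∣ M) (s≡cr⇒r≡q s≡cr) r∣M))
    where
    s≡cr⇒r≡q : ∀ {r} → s ≡ c * r → r ≡ q
    s≡cr⇒r≡q {r} s≡cr = ℕₚ.*-cancelˡ-≡ r q c (trans (sym s≡cr) (trans s≡qc (ℕₚ.*-comm q c)))
  ... | yes q∣M = begin
    ℕ∑.divisorSum M F                                          ≡⟨ ℕ∑.divisorSum-cong M (λ r _ → if-⇔ (s ℕ.≟ c * r) (r ℕ.≟ q) s≡cr⇒r≡q r≡q⇒s≡cr) ⟩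
    ℕ∑.divisorSum M (λ r → if does (r ℕ.≟ q) then f r else 0)  ≡⟨ ℕ∑.divisorSum-indicator M f q∣M ⟩
    f q                                                        ≡⟨ cong (maybe f 0) (scaledDivisor-hit q∣M) ⟨
    maybe f 0 (scaledDivisor M c (c * q))                      ≡⟨ cong (λ x → maybe f 0 (scaledDivisor M c x)) (sym s≡cq) ⟩
    maybe f 0 (scaledDivisor M c s)                            ∎
    where
    open ≡.≡-Reasoning
    s≡cq : s ≡ c * q
    s≡cq = trans s≡qc (ℕₚ.*-comm q c)
    s≡cr⇒r≡q : ∀ {r} → s ≡ c * r → r ≡ q
    s≡cr⇒r≡q {r} s≡cr = ℕₚ.*-cancelˡ-≡ r q c (trans (sym s≡cr) s≡cq)
    r≡q⇒s≡cr : ∀ {r} → r ≡ q → s ≡ c * r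
    r≡q⇒s≡cr refl = s≡cq

data SplitDivisor (p n m : ℕ) : ℕ → Set where
  split : ∀ {j t} → j ≤ n → t ∣ m → SplitDivisor p n m (p ^ j * t)

splitDivisor : ∀ {p m s} n → Prime p → s ∣ p ^ n * m → SplitDivisor p n m s
splitDivisor {p} {m} {s} zero p-prime s∣m =
  ≡.subst (SplitDivisor p 0 m) (ℕₚ.*-identityˡ s) (split z≤n (≡.subst (s ∣_) (ℕₚ.*-identityˡ m) s∣m))
splitDivisor {p} {m} {s} (suc n) p-prime s∣pⁿ⁺¹m with p ∣? s
... | no  p∤s = ≡.subst (SplitDivisor p (suc n) m) (ℕₚ.*-identityˡ s) (split z≤n (∣p^k*t⇒∣t (suc n) p-prime p∤s s∣pⁿ⁺¹m))
... | yes (divides q refl) with splitDivisor {s = q} n p-prime q∣pⁿm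
  where
  q∣pⁿm : q ∣ p ^ n * m
  q∣pⁿm = *-cancelʳ-∣ p ⦃ prime⇒nonZero p-prime ⦄ (≡.subst (q * p ∣_) (trans (ℕₚ.*-assoc p (p ^ n) m) (ℕₚ.*-comm p (p ^ n * m))) s∣pⁿ⁺¹m)
...   | split {j} {t} j≤n t∣m =
  ≡.subst (SplitDivisor p (suc n) m) (trans (ℕₚ.*-assoc p (p ^ j) t) (ℕₚ.*-comm p (p ^ j * t))) (split (s≤s j≤n) t∣m)

p^*-injective : ∀ {p t u} j k .{{_ : NonZero p}} → ¬ p ∣ t → ¬ p ∣ u → p ^ j * t ≡ p ^ k * u → j ≡ k
p^*-injective zero    zero    p∤t p∤u eq = refl
p^*-injective {p} {t} {u} zero (suc k) p∤t p∤u eq =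
  ⊥-elim (p∤t (≡.subst (p ∣_) (trans (sym (ℕₚ.*-assoc p (p ^ k) u)) (trans (sym eq) (ℕₚ.*-identityˡ t))) (m∣m*n (p ^ k * u))))
p^*-injective {p} {t} {u} (suc j) zero p∤t p∤u eq =
  ⊥-elim (p∤u (≡.subst (p ∣_) (trans (sym (ℕₚ.*-assoc p (p ^ j) t)) (trans eq (ℕₚ.*-identityˡ u))) (m∣m*n (p ^ j * t))))
p^*-injective {p} {t} {u} (suc j) (suc k) p∤t p∤u eq =
  cong suc (p^*-injective j k p∤t p∤u (ℕₚ.*-cancelˡ-≡ _ _ p (trans (sym (ℕₚ.*-assoc p (p ^ j) t)) (trans eq (ℕₚ.*-assoc p (p ^ k) u)))))

scaledDivisor-p^* : ∀ {p m t} j k .{{_ : NonZero p}} → ¬ p ∣ m → t ∣ m →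
  scaledDivisor m (p ^ k) (p ^ j * t) ≡ (if does (j ℕ.≟ k) then just t else nothing)
scaledDivisor-p^* {p} {m} {t} j k p∤m t∣m with j ℕ.≟ k
... | yes refl = trans (scaledDivisor-hit ⦃ ℕₚ.m^n≢0 p j ⦄ t∣m) (sym (if-yes (j ℕ.≟ j) refl))
... | no  j≢k  = trans (scaledDivisor-miss ⦃ ℕₚ.m^n≢0 p k ⦄ other) (sym (if-no (j ℕ.≟ k) j≢k))
  where
  other : ∀ u → p ^ j * t ≡ p ^ k * u → ¬ u ∣ m
  other u eq u∣m = j≢k (p^*-injective j k (λ p∣t → p∤m (∣-trans p∣t t∣m)) (λ p∣u → p∤m (∣-trans p∣u u∣m)) eq)

coefficient-p^* : ∀ {p m t} j k .{{_ : NonZero p}} (g : ℕ → ℤ) → ¬ p ∣ m → t ∣ m →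
  maybe g (+ 0) (scaledDivisor m (p ^ k) (p ^ j * t)) ≡ δ j k ℤ.* g t
coefficient-p^* {p} {m} {t} j k g p∤m t∣m = begin
  maybe g (+ 0) (scaledDivisor m (p ^ k) (p ^ j * t))         ≡⟨ cong (maybe g (+ 0)) (scaledDivisor-p^* j k p∤m t∣m) ⟩
  maybe g (+ 0) (if does (j ℕ.≟ k) then just t else nothing)  ≡⟨ if-float (maybe g (+ 0)) (does (j ℕ.≟ k)) ⟩
  (if does (j ℕ.≟ k) then g t else + 0)                       ≡⟨ indicator (does (j ℕ.≟ k)) ⟨
  δ j k ℤ.* g t                                               ∎
  where
  open ≡.≡-Reasoning
  indicator : ∀ b → (if b then + 1 else + 0) ℤ.* g t ≡ (if b then g t else + 0)
  indicator true  = ℤₚ.*-identityˡ (g t)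
  indicator false = refl

⁺-⁻ : ∀ c i → + (c * i ⁺) ℤ.- + (c * i ⁻) ≡ + c ℤ.* i
⁺-⁻ c (+ k)    = trans (cong (λ z → + (c * k) ℤ.- + z) (ℕₚ.*-zeroʳ c)) (trans (ℤₚ.+-identityʳ (+ (c * k))) (ℤₚ.pos-* c k))
⁺-⁻ c -[1+ k ] = trans (cong (λ z → + z ℤ.- + (c * suc k)) (ℕₚ.*-zeroʳ c)) (trans (cong (λ z → + 0 ℤ.- z) (ℤₚ.pos-* c (suc k))) (negate (+ c) (+ suc k)))
  where
  negate : ∀ x y → + 0 ℤ.- x ℤ.* y ≡ x ℤ.* ℤ.- y
  negate = solve-∀

exponents : ℕ → ℕ → (ℕ → ℕ) → ℕ → ℕ
exponents M c e = multiplicity (divisors M) (c *_) (λ t → c * e t)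

exponents-difference : ∀ M c (g : ℕ → ℤ) s .{{_ : NonZero M}} .{{_ : NonZero c}} →
  + exponents M c (λ t → g t ⁺) s ℤ.- + exponents M c (λ t → g t ⁻) s ≡ + c ℤ.* maybe g (+ 0) (scaledDivisor M c s)
exponents-difference M c g s = trans (cong₂ (λ u v → + u ℤ.- + v) (multiplicity-divisors M c (λ t → c * g t ⁺) s) (multiplicity-divisors M c (λ t → c * g t ⁻) s))
                                     (difference (scaledDivisor M c s))
  where
  difference : ∀ x → + maybe (λ t → c * g t ⁺) 0 x ℤ.- + maybe (λ t → c * g t ⁻) 0 x ≡ + c ℤ.* maybe g (+ 0) x
  difference (just t) = ⁺-⁻ c (g t)
  difference nothing  = sym (ℤₚ.*-zeroʳ (+ c))

+-cancel-differences : ∀ {a b c₁ d₁ c₂ d₂} → + a ℤ.- + b ≡ (+ c₁ ℤ.- + d₁) ℤ.- (+ c₂ ℤ.- + d₂) → a ℕ.+ (d₁ ℕ.+ c₂) ≡ (c₁ ℕ.+ d₂) ℕ.+ b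
+-cancel-differences {a} {b} {c₁} {d₁} {c₂} {d₂} eq = ℤₚ.+-injective (begin
  + a ℤ.+ (+ d₁ ℤ.+ + c₂)                                            ≡⟨ insert-b (+ a) (+ b) (+ d₁) (+ c₂) ⟩
  (+ a ℤ.- + b) ℤ.+ (+ b ℤ.+ + d₁ ℤ.+ + c₂)                          ≡⟨ cong (ℤ._+ (+ b ℤ.+ + d₁ ℤ.+ + c₂)) eq ⟩
  ((+ c₁ ℤ.- + d₁) ℤ.- (+ c₂ ℤ.- + d₂)) ℤ.+ (+ b ℤ.+ + d₁ ℤ.+ + c₂)  ≡⟨ collect (+ b) (+ c₁) (+ d₁) (+ c₂) (+ d₂) ⟩
  + c₁ ℤ.+ + d₂ ℤ.+ + b                                              ∎)
  where
  open ≡.≡-Reasoning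
  insert-b : ∀ a b d₁ c₂ → a ℤ.+ (d₁ ℤ.+ c₂) ≡ (a ℤ.- b) ℤ.+ (b ℤ.+ d₁ ℤ.+ c₂)
  insert-b = solve-∀
  collect : ∀ b c₁ d₁ c₂ d₂ → ((c₁ ℤ.- d₁) ℤ.- (c₂ ℤ.- d₂)) ℤ.+ (b ℤ.+ d₁ ℤ.+ c₂) ≡ c₁ ℤ.+ d₂ ℤ.+ b
  collect = solve-∀

∈-divisors⁻ : ∀ {M t} → t ∈ divisors M → t ∣ M
∈-divisors⁻ {M} t∈ = proj₂ (∈-filter⁻ (_∣? M) {xs = applyUpTo suc M} t∈)

-- The identity for N = p^(n+1)·m with p ∤ m

module PrimeSplitting {p m} (n : ℕ) .{{_ : NonZero m}} (p-prime : Prime p) (p∤m : ¬ p ∣ m) where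

  N : ℕ
  N = p ^ suc n * m

  private instance
    p≢0 : NonZero p
    p≢0 = prime⇒nonZero p-prime
    N≢0 : NonZero N
    N≢0 = ℕₚ.m*n≢0 (p ^ suc n) m ⦃ ℕₚ.m^n≢0 p (suc n) ⦄

  a-coefficient-identity : ∀ s →
    maybe (a N) (+ 0) (scaledDivisor N 1 s)
      ≡ + (p ^ suc n) ℤ.* maybe (a m) (+ 0) (scaledDivisor m (p ^ suc n) s) ℤ.- + (p ^ n) ℤ.* maybe (a m) (+ 0) (scaledDivisor m (p ^ n) s)
  a-coefficient-identity s with s ∣? N
  ... | no s∤N = begin
    maybe (a N) (+ 0) (scaledDivisor N 1 s)
      ≡⟨ cong (maybe (a N) (+ 0)) (scaledDivisor-miss (λ u s≡1u u∣N → s∤N (≡.subst (_∣ N) (sym (trans s≡1u (ℕₚ.*-identityˡ u))) u∣N))) ⟩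
    + 0
      ≡⟨ zeros (+ (p ^ suc n)) (+ (p ^ n)) ⟩
    + (p ^ suc n) ℤ.* + 0 ℤ.- + (p ^ n) ℤ.* + 0
      ≡⟨ cong₂ (λ x y → + (p ^ suc n) ℤ.* x ℤ.- + (p ^ n) ℤ.* y) (off-N (suc n) ℕₚ.≤-refl) (off-N n (ℕₚ.n≤1+n n)) ⟨
    + (p ^ suc n) ℤ.* maybe (a m) (+ 0) (scaledDivisor m (p ^ suc n) s) ℤ.- + (p ^ n) ℤ.* maybe (a m) (+ 0) (scaledDivisor m (p ^ n) s) ∎
    where
    open ≡.≡-Reasoning
    zeros : ∀ x y → + 0 ≡ x ℤ.* + 0 ℤ.- y ℤ.* + 0
    zeros = solve-∀
    off-N : ∀ k → k ≤ suc n → maybe (a m) (+ 0) (scaledDivisor m (p ^ k) s) ≡ + 0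
    off-N k k≤1+n = cong (maybe (a m) (+ 0)) (scaledDivisor-miss ⦃ ℕₚ.m^n≢0 p k ⦄
      (λ u s≡pᵏu u∣m → s∤N (≡.subst (_∣ N) (sym s≡pᵏu) (*-pres-∣ (p^-∣-p^ p-prime k≤1+n) u∣m))))
  ... | yes s∣N with splitDivisor (suc n) p-prime s∣N
  ...   | split {j} {t} j≤1+n t∣m = begin
    maybe (a N) (+ 0) (scaledDivisor N 1 (p ^ j * t))
      ≡⟨ cong (λ x → maybe (a N) (+ 0) (scaledDivisor N 1 x)) (ℕₚ.*-identityˡ (p ^ j * t)) ⟨
    maybe (a N) (+ 0) (scaledDivisor N 1 (1 * (p ^ j * t)))
      ≡⟨ cong (maybe (a N) (+ 0)) (scaledDivisor-hit {N} {1} (*-pres-∣ (p^-∣-p^ p-prime j≤1+n) t∣m)) ⟩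
    a N (p ^ j * t)
      ≡⟨ a-multiplicative p-prime (suc n) j p∤m t∣m j≤1+n ⟩
    a (p ^ suc n) (p ^ j) ℤ.* a m t
      ≡⟨ cong (ℤ._* a m t) (a-p^[1+n] p-prime n j≤1+n) ⟩
    (+ (p ^ suc n) ℤ.* δ j (suc n) ℤ.- + (p ^ n) ℤ.* δ j n) ℤ.* a m t
      ≡⟨ distribute (+ (p ^ suc n)) (+ (p ^ n)) (δ j (suc n)) (δ j n) (a m t) ⟩
    + (p ^ suc n) ℤ.* (δ j (suc n) ℤ.* a m t) ℤ.- + (p ^ n) ℤ.* (δ j n ℤ.* a m t)
      ≡⟨ cong₂ (λ x y → + (p ^ suc n) ℤ.* x ℤ.- + (p ^ n) ℤ.* y) (coefficient-p^* j (suc n) (a m) p∤m t∣m) (coefficient-p^* j n (a m) p∤m t∣m) ⟨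
    + (p ^ suc n) ℤ.* maybe (a m) (+ 0) (scaledDivisor m (p ^ suc n) (p ^ j * t))
      ℤ.- + (p ^ n) ℤ.* maybe (a m) (+ 0) (scaledDivisor m (p ^ n) (p ^ j * t)) ∎
    where
    open ≡.≡-Reasoning
    distribute : ∀ c₁ c₂ d₁ d₂ x → (c₁ ℤ.* d₁ ℤ.- c₂ ℤ.* d₂) ℤ.* x ≡ c₁ ℤ.* (d₁ ℤ.* x) ℤ.- c₂ ℤ.* (d₂ ℤ.* x)
    distribute = solve-∀

  eN⁺ eN⁻ e₁⁺ e₁⁻ e₂⁺ e₂⁻ : ℕ → ℕ
  eN⁺ = exponents N 1 (λ t → a N t ⁺)
  eN⁻ = exponents N 1 (λ t → a N t ⁻)
  e₁⁺ = exponents m (p ^ suc n) (λ t → a m t ⁺)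
  e₁⁻ = exponents m (p ^ suc n) (λ t → a m t ⁻)
  e₂⁺ = exponents m (p ^ n) (λ t → a m t ⁺)
  e₂⁻ = exponents m (p ^ n) (λ t → a m t ⁻)

  -- The identity of integer exponents, cross-multiplied so that only natural numbers occur.
  exponent-identity : ∀ s → eN⁺ s ℕ.+ (e₁⁻ s ℕ.+ e₂⁺ s) ≡ (e₁⁺ s ℕ.+ e₂⁻ s) ℕ.+ eN⁻ s
  exponent-identity s = +-cancel-differences {eN⁺ s} {eN⁻ s} {e₁⁺ s} {e₁⁻ s} {e₂⁺ s} {e₂⁻ s} (begin
    + eN⁺ s ℤ.- + eN⁻ s                                 ≡⟨ exponents-difference N 1 (a N) s ⟩
    + 1 ℤ.* maybe (a N) (+ 0) (scaledDivisor N 1 s)     ≡⟨ ℤₚ.*-identityˡ _ ⟩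
    maybe (a N) (+ 0) (scaledDivisor N 1 s)             ≡⟨ a-coefficient-identity s ⟩
    + (p ^ suc n) ℤ.* maybe (a m) (+ 0) (scaledDivisor m (p ^ suc n) s) ℤ.- + (p ^ n) ℤ.* maybe (a m) (+ 0) (scaledDivisor m (p ^ n) s)
      ≡⟨ cong₂ ℤ._-_ (exponents-difference m (p ^ suc n) (a m) s ⦃ it ⦄ ⦃ ℕₚ.m^n≢0 p (suc n) ⦄)
                     (exponents-difference m (p ^ n) (a m) s ⦃ it ⦄ ⦃ ℕₚ.m^n≢0 p n ⦄) ⟨
    (+ e₁⁺ s ℤ.- + e₁⁻ s) ℤ.- (+ e₂⁺ s ℤ.- + e₂⁻ s)     ∎)
    where open ≡.≡-Reasoning

  monomialΔ : (ℕ → ℕ) → PS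
  monomialΔ = ⊛M.monomial Δ[_] (suc N)

  divisorPowers-as-monomial : ∀ M c .{{_ : NonZero M}} (e : ℕ → ℕ) → c * M ≤ N →
    listSum (map (λ t → (c * e t) × Δ[ c * t ]) (divisors M)) ≗ monomialΔ (exponents M c e)
  divisorPowers-as-monomial M c e cM≤N = ⊛M.listSum-powers Δ[_] (suc N) (divisors M) (c *_) (λ t → c * e t)
    (λ t∈ → s≤s (ℕₚ.≤-trans (ℕₚ.*-monoʳ-≤ c (∣⇒≤ (∈-divisors⁻ t∈))) cM≤N))

  unscaled-as-monomial : ∀ (e : ℕ → ℕ) {f : PS} → f ≗ listSum (map (λ t → e t × Δ[ t ]) (divisors N)) →
    f ≗ monomialΔ (exponents N 1 e)
  unscaled-as-monomial e f≗ = ≗-trans f≗ (≗-trans (⊛∑.listSum-cong-∈ (divisors N) times-1)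
                                                   (divisorPowers-as-monomial N 1 e (ℕₚ.≤-reflexive (ℕₚ.*-identityˡ N))))
    where
    times-1 : ∀ {t} → t ∈ divisors N → e t × Δ[ t ] ≗ (1 * e t) × Δ[ 1 * t ]
    times-1 {t} _ = ×-cong (sym (ℕₚ.*-identityˡ (e t))) (λ k → cong (λ u → Δ[ u ] k) (sym (ℕₚ.*-identityˡ t)))

  scaled-as-monomial : ∀ k → k ≤ suc n → (e : ℕ → ℕ) {f : PS} → f ≗ listSum (map (λ t → e t × Δ[ t ]) (divisors m)) →
    powS (subS (p ^ k) f) (p ^ k) ≗ monomialΔ (exponents m (p ^ k) e)
  scaled-as-monomial k k≤1+n e f≗ =
    ≗-trans (powS-subS-listSum (p ^ k) ⦃ ℕₚ.m^n≢0 p k ⦄ (divisors m) e (λ t∈ → ∣⇒nonZero (∈-divisors⁻ t∈)) f≗)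
            (divisorPowers-as-monomial m (p ^ k) e (ℕₚ.*-monoˡ-≤ m (ℕₚ.^-monoʳ-≤ p k≤1+n)))

  ΔQ-identity : ΔQ N ≈Q divQ (powQ (subQ (p ^ suc n) (ΔQ m)) (p ^ suc n)) (powQ (subQ (p ^ n) (ΔQ m)) (p ^ n))
  ΔQ-identity = begin
    proj₁ (ΔQ N) ⊛ (F₁⁻ ⊛ F₂⁺)
      ≈⟨ ⊛-cong (unscaled-as-monomial _ (ΔQ-numerator N))
                (⊛-cong (scaled-as-monomial (suc n) ℕₚ.≤-refl _ (ΔQ-denominator m)) (scaled-as-monomial n (ℕₚ.n≤1+n n) _ (ΔQ-numerator m))) ⟩
    monomialΔ eN⁺ ⊛ (monomialΔ e₁⁻ ⊛ monomialΔ e₂⁺)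
      ≈⟨ ⊛-cong {monomialΔ eN⁺} (λ _ → refl) (⊛M.monomial-∙ Δ[_] (suc N) e₁⁻ e₂⁺) ⟩
    monomialΔ eN⁺ ⊛ monomialΔ (λ s → e₁⁻ s ℕ.+ e₂⁺ s)
      ≈⟨ ⊛M.monomial-∙ Δ[_] (suc N) eN⁺ (λ s → e₁⁻ s ℕ.+ e₂⁺ s) ⟩
    monomialΔ (λ s → eN⁺ s ℕ.+ (e₁⁻ s ℕ.+ e₂⁺ s))
      ≈⟨ ⊛M.monomial-cong Δ[_] (suc N) (λ s _ → exponent-identity s) ⟩
    monomialΔ (λ s → (e₁⁺ s ℕ.+ e₂⁻ s) ℕ.+ eN⁻ s)
      ≈⟨ ⊛M.monomial-∙ Δ[_] (suc N) (λ s → e₁⁺ s ℕ.+ e₂⁻ s) eN⁻ ⟨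
    monomialΔ (λ s → e₁⁺ s ℕ.+ e₂⁻ s) ⊛ monomialΔ eN⁻
      ≈⟨ ⊛-cong {g = monomialΔ eN⁻} (⊛M.monomial-∙ Δ[_] (suc N) e₁⁺ e₂⁻) (λ _ → refl) ⟨
    (monomialΔ e₁⁺ ⊛ monomialΔ e₂⁻) ⊛ monomialΔ eN⁻
      ≈⟨ ⊛-cong (⊛-cong (scaled-as-monomial (suc n) ℕₚ.≤-refl _ (ΔQ-numerator m)) (scaled-as-monomial n (ℕₚ.n≤1+n n) _ (ΔQ-denominator m)))
                (unscaled-as-monomial _ (ΔQ-denominator N)) ⟨
    (F₁⁺ ⊛ F₂⁻) ⊛ proj₂ (ΔQ N) ∎
    where
    open ⊛-Reasoning
    F₁⁺ F₁⁻ F₂⁺ F₂⁻ : PS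
    F₁⁺ = powS (subS (p ^ suc n) (proj₁ (ΔQ m))) (p ^ suc n)
    F₁⁻ = powS (subS (p ^ suc n) (proj₂ (ΔQ m))) (p ^ suc n)
    F₂⁺ = powS (subS (p ^ n) (proj₁ (ΔQ m))) (p ^ n)
    F₂⁻ = powS (subS (p ^ n) (proj₂ (ΔQ m))) (p ^ n)

lemma6p4p2 : (N p n Np : ℕ) → 1 ≤ N → Prime p → p ∣ N →
    N ≡ p ^ n * Np → ¬ (p ∣ Np) → 1 ≤ n →
    ΔQ N ≈Q divQ (powQ (subQ (p ^ n) (ΔQ Np)) (p ^ n)) (powQ (subQ (p ^ (n ∸ 1)) (ΔQ Np)) (p ^ (n ∸ 1)))
lemma6p4p2 _ p (suc n) Np 1≤N p-prime _ refl p∤Np _ =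
  PrimeSplitting.ΔQ-identity n ⦃ ℕₚ.m*n≢0⇒n≢0 (p ^ suc n) ⦃ ℕ.>-nonZero 1≤N ⦄ ⦄ p-prime p∤Np
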